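{- Let $S$ and $T$ be sets of complex clauses and $\epsilon$-blocks with $S\sqsubseteq T$, and let $\mathcal{T}$ be a tableau with $S\Rightarrow_{\prec,\phi}\mathcal{T}$. Then all clauses occurring in $\mathcal{T}$ are complex clauses or $\epsilon$-blocks, and $T\blacktriangleright^*\mathcal{T}'$ for some tableau $\mathcal{T}'$ with $\mathcal{T}\sqsubseteq\mathcal{T}'$.
   Context: Basic setting. Fix a finite signature $\Sigma$ with at least one constant, and let $r$ be its maximal arity. Variables are $x_1,x_2,\dots$, and $X_r=\{x_1,\dots,x_r\}$. All predicates are unary. Clauses are finite sets of literals. A term, literal or clause is trivial if it contains no function symbols. $C_1\sqcup\dots\sqcup C_n$ denotes $C_1\cup\dots\cup C_n$ where the $C_i$ have pairwise disjoint variables and $C_i\ne\emptyset$ for $i\ge2$. Clause kinds. - A flat clause is $\bigvee_{i=1}^k\pm_iP_i(f_i(x^i_1,\dots,x^i_{n_i}))\lor\bigvee_{j=1}^l\pm_jQ_j(x_j)$ with $\{x^i_1,\dots,x^i_{n_i}\}$ equal to the set of all variables of the clause for each $i$. It is complex if $k\ge1$. - An $\epsilon$-block is a clause with at most one variable containing only trivial literals (the empty clause $\Box$ included). - An $\epsilon$-clause is a clause $B_1[y_1]\sqcup\dots\sqcup B_n[y_n]$ with each $B_i$ an $\epsilon$-block. - Up to renaming, complex clauses have variables in $X_r$ and $\epsilon$-blocks have variables in $\{x_{r+1}\}$. For an $\epsilon$-block $B$ and variable $y$, $B[y]$ is $B$ with its variable renamed to $y$. Instances. - For a clause $C$ and set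 of terms $N$, $C[N]$ is the set of instances of $C$ obtained by substituting terms of $N$ for its variables. - $\pi(C)=C[X_r]$. - $\mathsf{U}=\{f(y_1,\dots,y_n)\mid f\in\Sigma,y_i\in X_r\}$. - For a clause set $S$, $\mathsf{comp}(S)$ and $\mathsf{eps}(S)$ are its complex clauses and its $\epsilon$-blocks, $\pi(S)=\bigcup_{C\in S}\pi(C)$, and $\mathsf{I}(S)=\pi(\mathsf{comp}(S))\cup\mathsf{eps}(S)[x_{r+1}]\cup\mathsf{eps}(S)[\mathsf{U}]$. - $S\vDash_{\mathrm{p}}T$ means $T$ follows from $S$ propositionally, treating every (possibly non-ground) atom as a distinct propositional variable. Tableaux. A tableau $S_1\mid\dots\mid S_n$ ($n\ge0$, with $\mid$ associative and commutative) is a multiset of clause sets (branches); it is closed if every branch contains $\Box$. Succinct representation $\sqsubseteq$. - For sets $S$, $T$ of complex clauses and $\epsilon$-blocks, $S\sqsubseteq T$ means: for every complex $C\in S$, $\mathsf{I}(T)\vDash_{\mathrm{p}}\pi(C)$; and for every $\epsilon$-block $C\in S$, $C[x_{r+1}]\in\mathsf{eps}(T)[x_{r+1}]$. - For tableaux, $\mathcal{T}_1\sqsubseteq\mathcal{T}_2$ if one can write $\mathcal{T}_1=S_1\mid\dots\mid S_n$ and $\mathcal{T}_2=T_1\mid\dots\mid T_n$ with $S_i\sqsubseteq T_i$ for all $i$. Resolution relation $\Rightarrow_{\prec,\phi}$. - The ordering is the subterm ordering, $P(s)\prec Q(t)$ iff $s$ is a strict subterm of $t$. A literal $\pm A$ is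 maximal in $C$ if no $\pm'B\in C$ has $A\prec B$. - Binary ordered resolution derives $C_1\sigma\lor C_2\sigma$ from renamed-apart $C_1\lor A$ and $-B\lor C_2$, with $\sigma=\mathrm{mgu}(A,B)$ and $A$, $B$ maximal in their premises. - Ordered factorization derives $C_1\sigma\lor\pm A\sigma$ from $C_1\lor\pm A\lor\pm B$, with $\sigma=\mathrm{mgu}(A,B)$ and $A$, $B$ maximal. - $S\Rightarrow_\prec S\cup\{C\}$ if $C$ is obtained by one such step from clauses of $S$. This is extended to tableaux by acting on one branch. - Splitting: $\mathcal{T}\mid S\rightarrow_{spl}\mathcal{T}\mid(S\setminus\{C_1\sqcup C_2\})\cup\{C_1\}\mid(S\setminus\{C_1\sqcup C_2\})\cup\{C_2\}$ for $C_1\sqcup C_2\in S$ with $C_1$, $C_2$ non-empty. $\epsilon$-splitting is splitting where one component is an $\epsilon$-block. - $\phi$ applies $\epsilon$-splitting repeatedly as long as possible, and $\mathcal{T}_1\Rightarrow_{\prec,\phi}\phi(\mathcal{T}_2)$ whenever $\mathcal{T}_1\Rightarrow_\prec\mathcal{T}_2$. Abstract step $\blacktriangleright$. $\mathcal{T}\mid S\blacktriangleright\mathcal{T}\mid S\cup\{B_1\}\mid\dots\mid S\cup\{B_k\}$ whenever $\mathsf{I}(S)\vDash_{\mathrm{p}}C$, where $C=B_1[x_{i_1}]\sqcup\dots\sqcup B_k[x_{i_k}]$ is an $\epsilon$-clause with $1\le i_1,\dots,i_k\le r+1$. -}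

module Defs where

open import Data.Nat using (ℕ; _≤_; _<_)
open import Data.Bool using (Bool; true; false)
open import Data.Product using (Σ; ∃; ∃-syntax; _×_; _,_; proj₁; proj₂)
open import Data.Sum using (_⊎_)
open import Data.Empty using (⊥)
open import Data.List using (List; []; _∷_; _++_; map; concatMap)
open import Data.List.Membership.Propositional using (_∈_; _∉_)
open import Data.List.Relation.Binary.Subset.Propositional using (_⊆_)
open import Data.List.Relation.Unary.All using (All)
open import Data.List.Relation.Unary.AllPairs using (AllPairs)
open import Data.List.Relation.Binary.Permutation.Propositional using (_↭_)
open import Data.List.Relation.Binary.Pointwise using (Pointwise)
open import Data.Vec using (Vec)
import Data.Vec as Vec
import Data.Vec.Membership.Propositional as VecMem
open import Relation.Binary.PropositionalEquality using (_≡_; _≢_)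
open import Relation.Binary.Definitions using (DecidableEquality)
open import Relation.Binary.Construct.Closure.ReflexiveTransitive using (Star)
open import Relation.Nullary using (¬_)
open import Function.Definitions using (Injective)

-- A finite signature with at least one constant; r is its maximal arity.
-- All predicate symbols are unary.

record Signature : Set₁ where
  field
    Fun            : Set
    arity          : Fun → ℕ
    Pred           : Set
    _≟F_           : DecidableEquality Fun
    _≟P_           : DecidableEquality Pred
    funs           : List Fun
    funs-complete  : ∀ f → f ∈ funs
    preds          : List Pred
    preds-complete : ∀ P → P ∈ preds
    constant       : ∃[ c ] (arity c ≡ 0)
    r              : ℕ
    r-bound        : ∀ f → arity f ≤ r
    r-attained     : ∃[ f ] (arity f ≡ r)

_iff_ : ∀ {a b} → Set a → Set b → Set _
A iff B = (A → B) × (B → A)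

module Syntax (sig : Signature) where
  open Signature sig

  -- Variables: var i stands for x_(i+1).  So X_r = {var i | i < r}
  -- and x_(r+1) = var r.
  data Term : Set where
    var : ℕ → Term
    app : (f : Fun) → Vec Term (arity f) → Term

  data _occ_ (x : ℕ) : Term → Set where
    occ-var : x occ var x
    occ-app : ∀ {f ts t} → t VecMem.∈ ts → x occ t → x occ app f ts

  data _⊏_ (s : Term) : Term → Set where
    sub : ∀ {f ts t} → t VecMem.∈ ts → (s ≡ t ⊎ s ⊏ t) → s ⊏ app f ts

  Atom : Set
  Atom = Pred × Term

  -- literal: sign (true = positive) and atom
  Literal : Set
  Literal = Bool × Atom

  argL : Literal → Term
  argL (_ , _ , t) = t

  Clause : Set
  Clause = List Literal

  -- clauses are finite sets of literals: equality as sets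
  _≈_ : Clause → Clause → Set
  C ≈ D = (C ⊆ D) × (D ⊆ C)

  Subst : Set
  Subst = ℕ → Term

  mutual
    _⟪_⟫ : Term → Subst → Term
    var x ⟪ σ ⟫ = σ x
    app f ts ⟪ σ ⟫ = app f (substVec ts σ)

    substVec : ∀ {n} → Vec Term n → Subst → Vec Term n
    substVec Vec.[] σ = Vec.[]
    substVec (t Vec.∷ ts) σ = (t ⟪ σ ⟫) Vec.∷ substVec ts σ

  _⟪_⟫A : Atom → Subst → Atom
  (P , t) ⟪ σ ⟫A = P , (t ⟪ σ ⟫)

  _⟪_⟫L : Literal → Subst → Literal
  (s , a) ⟪ σ ⟫L = s , (a ⟪ σ ⟫A)

  _⟪_⟫C : Clause → Subst → Clause
  C ⟪ σ ⟫C = map (λ L → L ⟪ σ ⟫L) C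

  VarOf : ℕ → Clause → Set
  VarOf x C = ∃[ L ] (L ∈ C × x occ argL L)

  DisjointVars : Clause → Clause → Set
  DisjointVars C D = ∀ x → VarOf x C → ¬ VarOf x D

  IsVar : Term → Set
  IsVar t = ∃[ x ] (t ≡ var x)

  FunOfVars : Term → Set
  FunOfVars t = ∃[ f ] Σ (Vec ℕ (arity f)) λ xs → t ≡ app f (Vec.map var xs)

  FlatLit : Clause → Literal → Set
  FlatLit C L =
    IsVar (argL L)
    ⊎ (∃[ f ] Σ (Vec ℕ (arity f)) λ xs →
         (argL L ≡ app f (Vec.map var xs))
         × (∀ y → (y VecMem.∈ xs) iff VarOf y C))

  Flat : Clause → Set
  Flat C = ∀ L → L ∈ C → FlatLit C L

  Complex : Clause → Set
  Complex C = Flat C × ∃[ L ] (L ∈ C × FunOfVars (argL L))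

  -- epsilon-blocks: at most one variable, only trivial literals
  -- (a literal is trivial iff its argument contains no function symbol,
  -- i.e. is a variable, predicates being unary)
  EpsBlock : Clause → Set
  EpsBlock B = (∀ L → L ∈ B → IsVar (argL L))
             × (∀ x y → VarOf x B → VarOf y B → x ≡ y)

  _[_]v : Clause → ℕ → Clause
  B [ y ]v = B ⟪ (λ _ → var y) ⟫C

  TermSet : Set₁
  TermSet = Term → Set

  ClauseSet : Set₁
  ClauseSet = Clause → Set

  Inst : Clause → TermSet → ClauseSet
  Inst C N D = ∃[ σ ] ((∀ x → VarOf x C → N (σ x)) × D ≈ (C ⟪ σ ⟫C))

  Xr : TermSet
  Xr t = ∃[ i ] (i < r × t ≡ var i)

  Xr+1 : TermSet
  Xr+1 t = t ≡ var r

  U : TermSet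
  U t = ∃[ f ] Σ (Vec ℕ (arity f)) λ xs →
          (∀ i → i VecMem.∈ xs → i < r) × (t ≡ app f (Vec.map var xs))

  π : Clause → ClauseSet
  π C = Inst C Xr

  I : ClauseSet → ClauseSet
  I S D = (∃[ C ] (S C × Complex C × π C D))
        ⊎ (∃[ B ] (S B × EpsBlock B × Inst B Xr+1 D))
        ⊎ (∃[ B ] (S B × EpsBlock B × Inst B U D))

  -- propositional entailment (atoms as propositional variables)
  Valuation : Set
  Valuation = Atom → Bool

  TrueLit : Valuation → Literal → Set
  TrueLit v (s , a) = v a ≡ s

  Sat : Valuation → Clause → Set
  Sat v C = ∃[ L ] (L ∈ C × TrueLit v L)

  _⊨p_ : ClauseSet → ClauseSet → Set
  S ⊨p T = ∀ (v : Valuation) → (∀ C → S C → Sat v C) → ∀ D → T D → Sat v D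

  _⊑_ : ClauseSet → ClauseSet → Set
  S ⊑ T = (∀ C → S C → Complex C → I T ⊨p π C)
        × (∀ C → S C → EpsBlock C →
             ∃[ B ] (T B × EpsBlock B × (C [ r ]v) ≈ (B [ r ]v)))

  _∪｛_｝ : ClauseSet → Clause → ClauseSet
  (S ∪｛ C ｝) X = S X ⊎ X ≡ C

  _∖｛_｝ : ClauseSet → Clause → ClauseSet
  (S ∖｛ C ｝) X = S X × ¬ (X ≈ C)

  -- tableaux: multisets of branches (lists up to permutation)
  Tableau : Set₁
  Tableau = List ClauseSet

  _⊑T_ : Tableau → Tableau → Set₁
  T₁ ⊑T T₂ = ∃[ T₂' ] (T₂' ↭ T₂ × Pointwise _⊑_ T₁ T₂')

  Maximal : Literal → Clause → Set
  Maximal L C = ∀ L' → L' ∈ C → ¬ (argL L ⊏ argL L')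

  Unifies : Subst → Atom → Atom → Set
  Unifies σ A B = (A ⟪ σ ⟫A) ≡ (B ⟪ σ ⟫A)

  MGU : Subst → Atom → Atom → Set
  MGU σ A B = Unifies σ A B
            × (∀ τ → Unifies τ A B → ∃[ ρ ] (∀ x → τ x ≡ (σ x ⟪ ρ ⟫)))

  Variant : Clause → Clause → Set
  Variant D D' = ∃[ ρ ] (Injective _≡_ _≡_ ρ × D ≈ (D' ⟪ (λ x → var (ρ x)) ⟫C))

  Resolvent : ClauseSet → Clause → Set
  Resolvent S E =
    ∃[ D₁' ] ∃[ D₂' ] ∃[ D₁ ] ∃[ D₂ ] ∃[ C₁ ] ∃[ C₂ ] ∃[ A ] ∃[ B ] ∃[ σ ]
      ( S D₁' × S D₂' × Variant D₁ D₁' × Variant D₂ D₂' × DisjointVars D₁ D₂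
      × D₁ ≈ ((true , A) ∷ C₁) × (true , A) ∉ C₁
      × D₂ ≈ ((false , B) ∷ C₂) × (false , B) ∉ C₂
      × Maximal (true , A) D₁ × Maximal (false , B) D₂
      × MGU σ A B
      × E ≡ (C₁ ⟪ σ ⟫C) ++ (C₂ ⟪ σ ⟫C))

  Factor : ClauseSet → Clause → Set
  Factor S E =
    ∃[ D ] ∃[ s ] ∃[ A ] ∃[ B ] ∃[ C₁ ] ∃[ σ ]
      ( S D × D ≈ ((s , A) ∷ (s , B) ∷ C₁)
      × Maximal (s , A) D × Maximal (s , B) D
      × MGU σ A B
      × E ≡ ((s , (A ⟪ σ ⟫A)) ∷ (C₁ ⟪ σ ⟫C)))

  _⇒≺_ : Tableau → Tableau → Set₁
  T ⇒≺ T' = ∃[ S ] ∃[ R ] ∃[ E ]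
    ( T ↭ (S ∷ R) × (Resolvent S E ⊎ Factor S E) × T' ≡ ((S ∪｛ E ｝) ∷ R))

  NonEmpty : Clause → Set
  NonEmpty C = C ≢ []

  Split : Clause → Clause → Clause → Set
  Split C C₁ C₂ = C ≈ (C₁ ++ C₂) × NonEmpty C₁ × NonEmpty C₂ × DisjointVars C₁ C₂

  EpsSplittable : ClauseSet → Set
  EpsSplittable S = ∃[ C ] ∃[ C₁ ] ∃[ C₂ ]
    (S C × Split C C₁ C₂ × (EpsBlock C₁ ⊎ EpsBlock C₂))

  _→ε_ : Tableau → Tableau → Set₁
  T →ε T' = ∃[ S ] ∃[ R ] ∃[ C ] ∃[ C₁ ] ∃[ C₂ ]
    ( T ↭ (S ∷ R) × S C × Split C C₁ C₂ × (EpsBlock C₁ ⊎ EpsBlock C₂)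
    × T' ≡ (((S ∖｛ C ｝) ∪｛ C₁ ｝) ∷ ((S ∖｛ C ｝) ∪｛ C₂ ｝) ∷ R))

  IsPhi : Tableau → Tableau → Set₁
  IsPhi T T' = Star _→ε_ T T' × (∀ S → S ∈ T' → ¬ EpsSplittable S)

  _⇒φ_ : Tableau → Tableau → Set₁
  T ⇒φ T' = ∃[ T₂ ] (T ⇒≺ T₂ × IsPhi T₂ T')

  -- epsilon-clauses B₁[x_{i₁}] ⊔ ... ⊔ B_k[x_{i_k}], given as a list of
  -- pairs (B_j , i) where var i = x_(i+1), so the bound is i ≤ r
  blockAt : Clause × ℕ → Clause
  blockAt (B , i) = B [ i ]v

  EpsClause : List (Clause × ℕ) → Set
  EpsClause [] = ⊥
  EpsClause (b ∷ bs) =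
      All (λ p → EpsBlock (proj₁ p)) (b ∷ bs)
    × All (λ p → proj₂ p ≤ r) (b ∷ bs)
    × AllPairs (λ p q → DisjointVars (blockAt p) (blockAt q)) (b ∷ bs)
    × All (λ p → NonEmpty (proj₁ p)) bs

  epsClause : List (Clause × ℕ) → Clause
  epsClause bs = concatMap blockAt bs

  _▶_ : Tableau → Tableau → Set₁
  T ▶ T' = ∃[ S ] ∃[ R ] ∃[ bs ]
    ( T ↭ (S ∷ R) × EpsClause bs
    × (I S ⊨p (λ D → D ≡ epsClause bs))
    × T' ≡ (map (λ p → S ∪｛ proj₁ p ｝) bs ++ R))

  _▶*_ : Tableau → Tableau → Set₁
  _▶*_ = Star _▶_

  ComplexOrEps : ClauseSet → Set
  ComplexOrEps S = ∀ C → S C → Complex C ⊎ EpsBlock C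

-- If a premise of the inference is complex, the maximal literal it contributes is f(x̄) with x̄ all of
-- its variables, and the mgu σ merely renames x̄. So t = f(x̄)σ is flat and every literal of the
-- conclusion E is flat over the variables of t (the literals of an ε-block premise all become t).
-- Sending the variables of t into X_r turns the premises into clauses of π(comp T), or into ε-blocks of T
-- instantiated with an element of U, so I(T) propositionally entails the corresponding instance of E.
-- Hence E is complex and I(T) ⊨ π(E), or E is trivial and I(T) entails an injective renaming of E into
-- X_(r+1); when both premises are ε-blocks, E has a single variable and I(T) ⊨ E[x_(r+1)].
-- A complex E cannot be ε-split, so φ changes nothing and T itself still represents the branch. A trivial E
-- is split by φ into its one-variable parts; renamed apart by the injective renaming they form an ε-clause
-- entailed by I(T), and the single ▶-step from T on it represents the tableau produced by φ.

module Submission where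

open import Defs
open import Data.Bool using (true; false)
open import Data.Empty using (⊥; ⊥-elim)
open import Data.Fin using (toℕ)
open import Data.Fin.Properties using (toℕ<n; toℕ-injective)
open import Data.List using (List; []; _∷_; _++_; filter; length; map)
open import Data.List.Properties using (map-∘; map-cong; ++-identityʳ)
open import Data.List.Membership.Propositional using (_∈_)
open import Data.List.Membership.Propositional.Properties
  using (∈-map⁺; ∈-map⁻; ∈-++⁻; ∈-++⁺ˡ; ∈-++⁺ʳ; ∈-filter⁺; ∈-filter⁻)
open import Data.List.Relation.Unary.Any using (Any; here; there)
open import Data.List.Relation.Unary.All using (All; []; _∷_)
import Data.List.Relation.Unary.All as All
import Data.List.Relation.Unary.All.Properties as Allₚ
open import Data.List.Relation.Unary.AllPairs using (AllPairs; []; _∷_)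
import Data.List.Relation.Unary.AllPairs.Properties as AllPairsₚ
open import Data.List.Relation.Binary.Pointwise using (Pointwise; []; _∷_)
open import Data.List.Relation.Binary.Permutation.Propositional using (_↭_; ↭-refl; ↭-sym; ↭⇒↭ₛ)
import Data.List.Relation.Binary.Permutation.Propositional as Permutation
open import Data.List.Relation.Binary.Permutation.Propositional.Properties
  using (All-resp-↭; Any-resp-↭; ∈-resp-↭; ↭-length; ↭-singleton-inv)
import Data.List.Relation.Binary.Permutation.Setoid.Properties as PermutationSetoid
open import Data.Nat using (ℕ; _≤_; _<_)
open import Data.Nat.Properties using (_≟_; ≤-refl; ≤-trans; <⇒≤)
open import Data.Product using (Σ; ∃-syntax; _×_; _,_; proj₁; proj₂)
open import Data.Sum using (_⊎_; inj₁; inj₂; [_,_])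
open import Data.Vec using (Vec)
import Data.Vec as Vec
import Data.Vec.Membership.Propositional as Vec
import Data.Vec.Membership.Propositional.Properties as Vec
import Data.Vec.Membership.DecPropositional _≟_ as VecDec
import Data.Vec.Relation.Unary.Any as VecAny
import Data.Vec.Relation.Unary.Any.Properties as VecAnyₚ
open import Function using (_∘_)
open import Relation.Binary.Construct.Closure.ReflexiveTransitive using (Star; ε; _◅_)
open import Relation.Binary.PropositionalEquality
  using (_≡_; _≢_; refl; sym; trans; cong; cong₂; subst; setoid; resp₂)
open import Relation.Nullary using (¬_; yes; no)
open import Relation.Unary using (Decidable)
open import Relation.Unary.Properties using (∁?)

∈ᵥ-map⁻ : ∀ {A B : Set} {n} (f : A → B) {xs : Vec A n} {y} → y Vec.∈ Vec.map f xs → ∃[ x ] (x Vec.∈ xs × y ≡ f x)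
∈ᵥ-map⁻ f y∈ = Vec.fromAny (VecAnyₚ.map⁻ y∈)

position : ∀ {n} → Vec ℕ n → ℕ → ℕ
position ws x with x VecDec.∈? ws
... | yes x∈ = toℕ (VecAny.index x∈)
... | no _ = 0

position< : ∀ {n x} (ws : Vec ℕ n) → x Vec.∈ ws → position ws x < n
position< {x = x} ws x∈ with x VecDec.∈? ws
... | yes x∈′ = toℕ<n (VecAny.index x∈′)
... | no x∉ = ⊥-elim (x∉ x∈)

position-injective : ∀ {n x y} (ws : Vec ℕ n) → x Vec.∈ ws → y Vec.∈ ws → position ws x ≡ position ws y → x ≡ y
position-injective {x = x} {y} ws x∈ y∈ eq with x VecDec.∈? ws | y VecDec.∈? ws
... | no x∉ | _ = ⊥-elim (x∉ x∈)
... | yes _ | no y∉ = ⊥-elim (y∉ y∈)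
... | yes x∈′ | yes y∈′ =
  trans (VecAnyₚ.lookup-index x∈′) (trans (cong (Vec.lookup ws) (toℕ-injective eq)) (sym (VecAnyₚ.lookup-index y∈′)))

Pointwise-↭ : ∀ {a b ℓ} {A : Set a} {B : Set b} {R : A → B → Set ℓ} {xs xs′ : List A} {ys : List B}
            → Pointwise R xs ys → xs ↭ xs′ → ∃[ ys′ ] (ys ↭ ys′ × Pointwise R xs′ ys′)
Pointwise-↭ rs Permutation.refl = _ , ↭-refl , rs
Pointwise-↭ (r ∷ rs) (Permutation.prep _ xs↭) with Pointwise-↭ rs xs↭
... | _ , ys↭ , rs′ = _ , Permutation.prep _ ys↭ , r ∷ rs′
Pointwise-↭ (r₁ ∷ r₂ ∷ rs) (Permutation.swap _ _ xs↭) with Pointwise-↭ rs xs↭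
... | _ , ys↭ , rs′ = _ , Permutation.swap _ _ ys↭ , r₂ ∷ r₁ ∷ rs′
Pointwise-↭ rs (Permutation.trans xs↭ xs↭′) with Pointwise-↭ rs xs↭
... | _ , ys↭ , rs′ with Pointwise-↭ rs′ xs↭′
... | _ , ys↭′ , rs″ = _ , Permutation.trans ys↭ ys↭′ , rs″

AllPairs-restrict : ∀ {a p ℓ ℓ′} {A : Set a} {P : A → Set p} {R : A → A → Set ℓ} {R′ : A → A → Set ℓ′}
                  → (∀ {x y} → P x → P y → R x y → R′ x y) → ∀ {xs} → All P xs → AllPairs R xs → AllPairs R′ xs
AllPairs-restrict f [] [] = []
AllPairs-restrict {P = P} {R} {R′} f (px ∷ pxs) (rx ∷ rxs) = All-restrict px pxs rx ∷ AllPairs-restrict f pxs rxs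
  where
  All-restrict : ∀ {x ys} → P x → All P ys → All (R x) ys → All (R′ x) ys
  All-restrict px [] [] = []
  All-restrict px (py ∷ pys) (r ∷ rs) = f px py r ∷ All-restrict px pys rs

module _ (sig : Signature) where
  open Signature sig
  open Syntax sig

  -- Substitutions

  _⨾_ : Subst → Subst → Subst
  (σ ⨾ τ) x = σ x ⟪ τ ⟫

  ren : (ℕ → ℕ) → Subst
  ren ρ x = var (ρ x)

  substVec-map : ∀ {n} (ts : Vec Term n) σ → substVec ts σ ≡ Vec.map (_⟪ σ ⟫) ts
  substVec-map Vec.[] σ = refl
  substVec-map (t Vec.∷ ts) σ = cong (t ⟪ σ ⟫ Vec.∷_) (substVec-map ts σ)

  ∈-substVec⁻ : ∀ {n t} (ts : Vec Term n) σ → t Vec.∈ substVec ts σ → ∃[ u ] (u Vec.∈ ts × t ≡ u ⟪ σ ⟫)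
  ∈-substVec⁻ ts σ t∈ = ∈ᵥ-map⁻ (_⟪ σ ⟫) (subst (_ Vec.∈_) (substVec-map ts σ) t∈)

  ∈-substVec⁺ : ∀ {n t} (ts : Vec Term n) σ → t Vec.∈ ts → t ⟪ σ ⟫ Vec.∈ substVec ts σ
  ∈-substVec⁺ ts σ t∈ = subst (_ Vec.∈_) (sym (substVec-map ts σ)) (Vec.∈-map⁺ (_⟪ σ ⟫) t∈)

  mutual
    ⟪⟫-⨾ : ∀ t σ τ → (t ⟪ σ ⟫) ⟪ τ ⟫ ≡ t ⟪ σ ⨾ τ ⟫
    ⟪⟫-⨾ (var x) σ τ = refl
    ⟪⟫-⨾ (app f ts) σ τ = cong (app f) (substVec-⨾ ts σ τ)

    substVec-⨾ : ∀ {n} (ts : Vec Term n) σ τ → substVec (substVec ts σ) τ ≡ substVec ts (σ ⨾ τ)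
    substVec-⨾ Vec.[] σ τ = refl
    substVec-⨾ (t Vec.∷ ts) σ τ = cong₂ Vec._∷_ (⟪⟫-⨾ t σ τ) (substVec-⨾ ts σ τ)

  ⟪⟫L-⨾ : ∀ L σ τ → (L ⟪ σ ⟫L) ⟪ τ ⟫L ≡ L ⟪ σ ⨾ τ ⟫L
  ⟪⟫L-⨾ (s , P , t) σ τ = cong (λ u → s , P , u) (⟪⟫-⨾ t σ τ)

  ⟪⟫C-⨾ : ∀ C σ τ → (C ⟪ σ ⟫C) ⟪ τ ⟫C ≡ C ⟪ σ ⨾ τ ⟫C
  ⟪⟫C-⨾ C σ τ = trans (sym (map-∘ C)) (map-cong (λ L → ⟪⟫L-⨾ L σ τ) C)

  mutual
    ⟪⟫-local : ∀ t {σ τ} → (∀ x → x occ t → σ x ≡ τ x) → t ⟪ σ ⟫ ≡ t ⟪ τ ⟫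
    ⟪⟫-local (var x) eq = eq x occ-var
    ⟪⟫-local (app f ts) eq = cong (app f) (substVec-local ts (λ x t∈ o → eq x (occ-app t∈ o)))

    substVec-local : ∀ {n} (ts : Vec Term n) {σ τ} → (∀ x {t} → t Vec.∈ ts → x occ t → σ x ≡ τ x)
                   → substVec ts σ ≡ substVec ts τ
    substVec-local Vec.[] eq = refl
    substVec-local (t Vec.∷ ts) eq =
      cong₂ Vec._∷_ (⟪⟫-local t (λ x → eq x (VecAny.here refl))) (substVec-local ts (λ x t∈ → eq x (VecAny.there t∈)))

  ⟪⟫C-local : ∀ C {σ τ} → (∀ x → VarOf x C → σ x ≡ τ x) → C ⟪ σ ⟫C ≡ C ⟪ τ ⟫C
  ⟪⟫C-local [] eq = refl
  ⟪⟫C-local ((s , P , t) ∷ C) eq =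
    cong₂ _∷_ (cong (λ u → s , P , u) (⟪⟫-local t (λ x o → eq x (_ , here refl , o))))
              (⟪⟫C-local C (λ { x (L , L∈ , o) → eq x (L , there L∈ , o) }))

  mutual
    ⟪var⟫ : ∀ t → t ⟪ var ⟫ ≡ t
    ⟪var⟫ (var x) = refl
    ⟪var⟫ (app f ts) = cong (app f) (substVec-var ts)

    substVec-var : ∀ {n} (ts : Vec Term n) → substVec ts var ≡ ts
    substVec-var Vec.[] = refl
    substVec-var (t Vec.∷ ts) = cong₂ Vec._∷_ (⟪var⟫ t) (substVec-var ts)

  ⟪⟫-fixes : ∀ t {σ} → (∀ x → x occ t → σ x ≡ var x) → t ⟪ σ ⟫ ≡ t
  ⟪⟫-fixes t eq = trans (⟪⟫-local t eq) (⟪var⟫ t)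

  ⟪var⟫C : ∀ C → C ⟪ var ⟫C ≡ C
  ⟪var⟫C [] = refl
  ⟪var⟫C ((s , P , t) ∷ C) = cong₂ _∷_ (cong (λ u → s , P , u) (⟪var⟫ t)) (⟪var⟫C C)

  occ-⟪⟫⁻ : ∀ {x} t σ → x occ (t ⟪ σ ⟫) → ∃[ z ] (z occ t × x occ σ z)
  occ-⟪⟫⁻ (var z) σ o = z , occ-var , o
  occ-⟪⟫⁻ (app f ts) σ (occ-app t∈ o) with ∈-substVec⁻ ts σ t∈
  ... | u , u∈ , refl with occ-⟪⟫⁻ u σ o
  ... | z , oz , oσ = z , occ-app u∈ oz , oσ

  occ-⟪⟫⁺ : ∀ {x z} t σ → z occ t → x occ σ z → x occ (t ⟪ σ ⟫)
  occ-⟪⟫⁺ (var z) σ occ-var o = o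
  occ-⟪⟫⁺ (app f ts) σ (occ-app t∈ oz) o = occ-app (∈-substVec⁺ ts σ t∈) (occ-⟪⟫⁺ _ σ oz o)

  occ-ren : ∀ {x} t ρ → x occ (t ⟪ ren ρ ⟫) → ∃[ z ] (z occ t × x ≡ ρ z)
  occ-ren t ρ o with occ-⟪⟫⁻ t (ren ρ) o
  ... | z , oz , occ-var = z , oz , refl

  ∈-⟪⟫C⁻ : ∀ {L} C σ → L ∈ C ⟪ σ ⟫C → ∃[ K ] (K ∈ C × L ≡ K ⟪ σ ⟫L)
  ∈-⟪⟫C⁻ C σ = ∈-map⁻ (_⟪ σ ⟫L)

  ∈-⟪⟫C⁺ : ∀ {L} C σ → L ∈ C → L ⟪ σ ⟫L ∈ C ⟪ σ ⟫C
  ∈-⟪⟫C⁺ C σ = ∈-map⁺ (_⟪ σ ⟫L)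

  ⟪⟫C-mono : ∀ {C D} σ → (∀ {L} → L ∈ C → L ∈ D) → ∀ {L} → L ∈ C ⟪ σ ⟫C → L ∈ D ⟪ σ ⟫C
  ⟪⟫C-mono {C} {D} σ C⊆D L∈ with ∈-⟪⟫C⁻ C σ L∈
  ... | K , K∈ , refl = ∈-⟪⟫C⁺ D σ (C⊆D K∈)

  ≈-refl : ∀ {C} → C ≈ C
  ≈-refl = (λ L∈ → L∈) , (λ L∈ → L∈)

  VarOf-⊆ : ∀ {C D x} → (∀ {L} → L ∈ C → L ∈ D) → VarOf x C → VarOf x D
  VarOf-⊆ C⊆D (L , L∈ , o) = L , C⊆D L∈ , o

  DisjointVars-⊆ : ∀ {C C′ D} → (∀ {L} → L ∈ C → L ∈ C′) → DisjointVars C′ D → DisjointVars C D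
  DisjointVars-⊆ C⊆C′ disjoint x x∈ = disjoint x (VarOf-⊆ C⊆C′ x∈)

  var-occ : ∀ {t y} → t ≡ var y → y occ t
  var-occ refl = occ-var

  app≢var : ∀ {f ts x} → app f ts ≢ var x
  app≢var ()

  varIndex : Term → ℕ
  varIndex (var z) = z
  varIndex (app _ _) = 0

  -- Flat terms and flat clauses

  infix 8 _∙_
  _∙_ : (f : Fun) → Vec ℕ (arity f) → Term
  f ∙ ws = app f (Vec.map var ws)

  occ-∙⁻ : ∀ {x} f (ws : Vec ℕ (arity f)) → x occ (f ∙ ws) → x Vec.∈ ws
  occ-∙⁻ f ws (occ-app t∈ o) with ∈ᵥ-map⁻ var t∈
  occ-∙⁻ f ws (occ-app t∈ occ-var) | w , w∈ , refl = w∈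

  occ-∙⁺ : ∀ {x} f (ws : Vec ℕ (arity f)) → x Vec.∈ ws → x occ (f ∙ ws)
  occ-∙⁺ f ws x∈ = occ-app (Vec.∈-map⁺ var x∈) occ-var

  var⊏∙ : ∀ {x} f (ws : Vec ℕ (arity f)) → x Vec.∈ ws → var x ⊏ (f ∙ ws)
  var⊏∙ f ws x∈ = sub (Vec.∈-map⁺ var x∈) (inj₁ refl)

  substVec-map-var : ∀ {n} (ws : Vec ℕ n) σ (s : ℕ → ℕ) → (∀ w → w Vec.∈ ws → σ w ≡ var (s w))
                   → substVec (Vec.map var ws) σ ≡ Vec.map var (Vec.map s ws)
  substVec-map-var Vec.[] σ s eq = refl
  substVec-map-var (w Vec.∷ ws) σ s eq =
    cong₂ Vec._∷_ (eq w (VecAny.here refl)) (substVec-map-var ws σ s (λ w′ w∈ → eq w′ (VecAny.there w∈)))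

  ∙-⟪⟫ : ∀ f (ws : Vec ℕ (arity f)) σ (s : ℕ → ℕ) → (∀ w → w Vec.∈ ws → σ w ≡ var (s w))
       → (f ∙ ws) ⟪ σ ⟫ ≡ f ∙ Vec.map s ws
  ∙-⟪⟫ f ws σ s eq = cong (app f) (substVec-map-var ws σ s eq)

  FlatTerm : Term → Set
  FlatTerm b = ∃[ h ] Σ (Vec ℕ (arity h)) λ zs → b ≡ h ∙ zs

  FlatTerm-U : ∀ {t} θ → FlatTerm t → (∀ z → z occ t → Xr (θ z)) → U (t ⟪ θ ⟫)
  FlatTerm-U θ (h , ws , refl) θ∈Xr = h , vs , vs<r , cong (app h) ws≡vs
    where
    indices : ∀ {n} (us : Vec ℕ n) → (∀ u → u Vec.∈ us → Xr (θ u))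
            → Σ (Vec ℕ n) λ vs → (∀ i → i Vec.∈ vs → i < r) × substVec (Vec.map var us) θ ≡ Vec.map var vs
    indices Vec.[] _ = Vec.[] , (λ _ ()) , refl
    indices (u Vec.∷ us) us∈Xr with us∈Xr u (VecAny.here refl) | indices us (λ u′ u∈ → us∈Xr u′ (VecAny.there u∈))
    ... | i , i<r , eq | vs , vs<r , eqs = i Vec.∷ vs , bound , cong₂ Vec._∷_ eq eqs
      where
      bound : ∀ j → j Vec.∈ (i Vec.∷ vs) → j < r
      bound j (VecAny.here refl) = i<r
      bound j (VecAny.there j∈) = vs<r j j∈
    vs = proj₁ (indices ws (λ u u∈ → θ∈Xr u (occ-∙⁺ h ws u∈)))
    vs<r = proj₁ (proj₂ (indices ws (λ u u∈ → θ∈Xr u (occ-∙⁺ h ws u∈))))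
    ws≡vs = proj₂ (proj₂ (indices ws (λ u u∈ → θ∈Xr u (occ-∙⁺ h ws u∈))))

  VarSet : Set₁
  VarSet = ℕ → Set

  vars : Clause → VarSet
  vars C x = VarOf x C

  _≐_ : VarSet → VarSet → Set
  V ≐ W = ∀ y → V y iff W y

  image : (ℕ → ℕ) → VarSet → VarSet
  image s V y = ∃[ x ] (V x × y ≡ s x)

  FlatTermOver : VarSet → Term → Set
  FlatTermOver V t = ∃[ h ] Σ (Vec ℕ (arity h)) λ ws → t ≡ h ∙ ws × (∀ y → (y Vec.∈ ws) iff V y)

  FlatLitOver : VarSet → Literal → Set
  FlatLitOver V L = (∃[ w ] (argL L ≡ var w × V w)) ⊎ FlatTermOver V (argL L)

  FlatOver : VarSet → Clause → Set
  FlatOver V C = ∀ L → L ∈ C → FlatLitOver V L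

  ComplexOver : VarSet → Clause → Set
  ComplexOver V C = FlatOver V C × ∃[ K ] (K ∈ C × FlatTermOver V (argL K))

  FlatTermOver⇒FlatTerm : ∀ {V t} → FlatTermOver V t → FlatTerm t
  FlatTermOver⇒FlatTerm (h , ws , eq , _) = h , ws , eq

  FlatTermOver-occ : ∀ {V t} → FlatTermOver V t → V ≐ (_occ t)
  FlatTermOver-occ (h , ws , refl , ws≐V) y =
    (λ Vy → occ-∙⁺ h ws (proj₂ (ws≐V y) Vy)) , (λ o → proj₁ (ws≐V y) (occ-∙⁻ h ws o))

  FlatTerm-self : ∀ {t} → FlatTerm t → FlatTermOver (_occ t) t
  FlatTerm-self (h , ws , refl) = h , ws , refl , λ y → occ-∙⁺ h ws , occ-∙⁻ h ws

  FlatTermOver-resp : ∀ {V W t} → V ≐ W → FlatTermOver V t → FlatTermOver W t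
  FlatTermOver-resp V≐W (h , ws , refl , ws≐V) =
    h , ws , refl , λ y → (λ y∈ → proj₁ (V≐W y) (proj₁ (ws≐V y) y∈)) , (λ Wy → proj₂ (ws≐V y) (proj₂ (V≐W y) Wy))

  FlatOver-resp : ∀ {V W C} → V ≐ W → FlatOver V C → FlatOver W C
  FlatOver-resp V≐W flat L L∈ with flat L L∈
  ... | inj₁ (w , eq , Vw) = inj₁ (w , eq , proj₁ (V≐W w) Vw)
  ... | inj₂ ft = inj₂ (FlatTermOver-resp V≐W ft)

  FlatOver-++ : ∀ {V} C D → FlatOver V C → FlatOver V D → FlatOver V (C ++ D)
  FlatOver-++ C D flatC flatD L L∈ with ∈-++⁻ C L∈
  ... | inj₁ L∈C = flatC L L∈C
  ... | inj₂ L∈D = flatD L L∈D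

  module _ {V : VarSet} (σ : Subst) (s : ℕ → ℕ) (σ≗s : ∀ x → V x → σ x ≡ var (s x)) where

    FlatTermOver-⟪⟫ : ∀ t → FlatTermOver V t → FlatTermOver (image s V) (t ⟪ σ ⟫)
    FlatTermOver-⟪⟫ _ (h , ws , refl , ws≐V) =
      h , Vec.map s ws , ∙-⟪⟫ h ws σ s (λ w w∈ → σ≗s w (proj₁ (ws≐V w) w∈)) ,
      λ y → (λ y∈ → let (w , w∈ , eq) = ∈ᵥ-map⁻ s y∈ in w , proj₁ (ws≐V w) w∈ , eq) ,
            (λ { (x , Vx , refl) → Vec.∈-map⁺ s (proj₂ (ws≐V x) Vx) })

    FlatLitOver-⟪⟫ : ∀ L → FlatLitOver V L → FlatLitOver (image s V) (L ⟪ σ ⟫L)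
    FlatLitOver-⟪⟫ (b , P , .(var w)) (inj₁ (w , refl , Vw)) = inj₁ (s w , σ≗s w Vw , w , Vw , refl)
    FlatLitOver-⟪⟫ (b , P , t) (inj₂ ft) = inj₂ (FlatTermOver-⟪⟫ t ft)

    FlatOver-⟪⟫ : ∀ C → FlatOver V C → FlatOver (image s V) (C ⟪ σ ⟫C)
    FlatOver-⟪⟫ C flat L L∈ with ∈-⟪⟫C⁻ C σ L∈
    ... | K , K∈ , refl = FlatLitOver-⟪⟫ K (flat K K∈)

    ComplexOver-⟪⟫ : ∀ C → ComplexOver V C → ComplexOver (image s V) (C ⟪ σ ⟫C)
    ComplexOver-⟪⟫ C (flat , K , K∈ , ft) =
      FlatOver-⟪⟫ C flat , K ⟪ σ ⟫L , ∈-⟪⟫C⁺ C σ K∈ , FlatTermOver-⟪⟫ (argL K) ft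

  ComplexOver-≈ : ∀ {V C C′} → C ≈ C′ → ComplexOver V C′ → ComplexOver V C
  ComplexOver-≈ (C⊆ , ⊆C) (flat , K , K∈ , ft) = (λ L L∈ → flat L (C⊆ L∈)) , K , ⊆C K∈ , ft

  complex⇒ComplexOver : ∀ {C} → Complex C → ComplexOver (vars C) C
  complex⇒ComplexOver {C} (flat , K , K∈ , _ , _ , K≡app) = flatOver , K , K∈ , complexK
    where
    flatOver : FlatOver (vars C) C
    flatOver L L∈ with flat L L∈
    ... | inj₁ (w , eq) = inj₁ (w , eq , L , L∈ , var-occ eq)
    ... | inj₂ ft = inj₂ ft
    complexK : FlatTermOver (vars C) (argL K)
    complexK with flat K K∈
    ... | inj₁ (_ , eq) = ⊥-elim (app≢var (trans (sym K≡app) eq))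
    ... | inj₂ ft = ft

  FlatLitOver-vars : ∀ {V L y} → FlatLitOver V L → y occ argL L → V y
  FlatLitOver-vars {y = y} (inj₁ (w , eq , Vw)) o with subst (y occ_) eq o
  ... | occ-var = Vw
  FlatLitOver-vars {y = y} (inj₂ (h , ws , eq , ws≐V)) o = proj₁ (ws≐V y) (occ-∙⁻ h ws (subst (y occ_) eq o))

  ComplexOver-vars : ∀ {V C} → ComplexOver V C → V ≐ vars C
  ComplexOver-vars {V} (flat , K , K∈ , h , ws , eq , ws≐V) y =
    (λ Vy → K , K∈ , subst (y occ_) (sym eq) (occ-∙⁺ h ws (proj₂ (ws≐V y) Vy))) ,
    (λ { (L , L∈ , o) → FlatLitOver-vars {V} {L} (flat L L∈) o })

  ComplexOver⇒complex : ∀ {V C} → ComplexOver V C → Complex C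
  ComplexOver⇒complex {V} {C} cx@(flat , K , K∈ , h , ws , eq , _) = flat′ , K , K∈ , h , ws , eq
    where
    V≐C : V ≐ vars C
    V≐C = ComplexOver-vars cx
    flat′ : Flat C
    flat′ L L∈ with flat L L∈
    ... | inj₁ (w , eq , _) = inj₁ (w , eq)
    ... | inj₂ (g , vs , eq , vs≐V) =
      inj₂ (g , vs , eq , λ y → (λ y∈ → proj₁ (V≐C y) (proj₁ (vs≐V y) y∈)) ,
                                (λ y∈C → proj₂ (vs≐V y) (proj₂ (V≐C y) y∈C)))

  maximal-flat : ∀ {V D L} → ComplexOver V D → L ∈ D → Maximal L D → FlatTermOver V (argL L)
  maximal-flat {V} {D} {L} (flat , K , K∈ , h , ws , eqK , ws≐V) L∈ max with flat L L∈
  ... | inj₂ ft = ft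
  ... | inj₁ (w , eq , Vw) =
    ⊥-elim (max K K∈ (subst₂ eq (sym eqK) (var⊏∙ h ws (proj₂ (ws≐V w) Vw))))
    where
    subst₂ : ∀ {a b c d} → a ≡ b → c ≡ d → b ⊏ c → a ⊏ d
    subst₂ refl refl p = p

  -- Trivial clauses and ε-blocks

  AllTrivial : Clause → Set
  AllTrivial E = ∀ L → L ∈ E → IsVar (argL L)

  complex-or-trivial : ∀ E → (∃[ K ] (K ∈ E × ∃[ f ] ∃[ ts ] (argL K ≡ app f ts))) ⊎ AllTrivial E
  complex-or-trivial [] = inj₂ (λ _ ())
  complex-or-trivial ((b , P , app f ts) ∷ E) = inj₁ (_ , here refl , f , ts , refl)
  complex-or-trivial ((b , P , var w) ∷ E) with complex-or-trivial E
  ... | inj₁ (K , K∈ , K-app) = inj₁ (K , there K∈ , K-app)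
  ... | inj₂ trivial = inj₂ λ { L (here refl) → w , refl ; L (there L∈) → trivial L L∈ }

  AllTrivial-occ : ∀ {P L x} → AllTrivial P → L ∈ P → x occ argL L → x ≡ varIndex (argL L)
  AllTrivial-occ {L = L} trivial L∈ o with trivial L L∈
  ... | w , eq with subst (_ occ_) eq o
  ... | occ-var = cong varIndex (sym eq)

  Uniform : Term → Clause → Set
  Uniform t C = ∀ L → L ∈ C → argL L ≡ t

  Uniform-⟪⟫ : ∀ {t} C σ → Uniform t C → Uniform (t ⟪ σ ⟫) (C ⟪ σ ⟫C)
  Uniform-⟪⟫ C σ unif L L∈ with ∈-⟪⟫C⁻ C σ L∈
  ... | K , K∈ , refl = cong (_⟪ σ ⟫) (unif K K∈)

  Uniform-var-vars : ∀ {z C} → Uniform (var z) C → ∀ x → VarOf x C → x ≡ z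
  Uniform-var-vars unif x (L , L∈ , o) with subst (x occ_) (unif L L∈) o
  ... | occ-var = refl

  EpsBlock-uniform : ∀ {D L y} → EpsBlock D → L ∈ D → argL L ≡ var y → Uniform (var y) D
  EpsBlock-uniform {y = y} (trivial , one-var) L∈ eq K K∈ with trivial K K∈
  ... | w , eqK = trans eqK (cong var (one-var w y (K , K∈ , var-occ eqK)
                                                 (_ , L∈ , var-occ eq)))

  EpsBlock-ren : ∀ {D′ D} ρ → EpsBlock D′ → D ≈ (D′ ⟪ ren ρ ⟫C) → EpsBlock D
  EpsBlock-ren {D′} {D} ρ (trivial , one-var) (D⊆ , _) = trivial′ , one-var′
    where
    trivial′ : ∀ L → L ∈ D → IsVar (argL L)
    trivial′ L L∈ with ∈-⟪⟫C⁻ D′ (ren ρ) (D⊆ L∈)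
    ... | K , K∈ , refl with trivial K K∈
    ... | w , eq = ρ w , cong (_⟪ ren ρ ⟫) eq
    preimage : ∀ x → VarOf x D → ∃[ z ] (VarOf z D′ × x ≡ ρ z)
    preimage x (L , L∈ , o) with ∈-⟪⟫C⁻ D′ (ren ρ) (D⊆ L∈)
    ... | K , K∈ , refl with occ-ren (argL K) ρ o
    ... | z , oz , eq = z , (K , K∈ , oz) , eq
    one-var′ : ∀ x y → VarOf x D → VarOf y D → x ≡ y
    one-var′ x y x∈ y∈ with preimage x x∈ | preimage y y∈
    ... | z , z∈ , refl | z′ , z′∈ , refl = cong ρ (one-var z z′ z∈ z′∈)

  complex-not-EpsBlock : ∀ {C} → Complex C → EpsBlock C → ⊥
  complex-not-EpsBlock (_ , K , K∈ , _ , _ , eqK) (trivial , _) with trivial K K∈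
  ... | _ , eq = app≢var (trans (sym eqK) eq)

  -- Most general unifiers

  Renames : Subst → (ℕ → Set) → Set
  Renames σ V = ∀ x → V x → σ x ≡ var (varIndex (σ x))

  mgu-sym : ∀ {σ} A B → MGU σ A B → MGU σ B A
  mgu-sym _ _ (unif , general) = sym unif , λ τ unifτ → general τ (sym unifτ)

  mgu-renames : ∀ {σ} A B τ → MGU σ A B → Unifies τ A B → Renames σ (λ x → IsVar (τ x))
  mgu-renames {σ} _ _ τ (_ , general) unifτ x (z , τx≡z) with general τ unifτ | σ x in σx≡
  ... | ρ , τ≡σρ | var _ = refl
  ... | ρ , τ≡σρ | app _ _ = ⊥-elim (app≢var (trans (cong (_⟪ ρ ⟫) (sym σx≡)) (trans (sym (τ≡σρ x)) τx≡z)))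

  collapse : Subst
  collapse _ = var 0

  _↦_ : ℕ → Term → Subst
  (y ↦ u) z with z ≟ y
  ... | yes _ = u
  ... | no _ = var z

  ↦-same : ∀ y u → (y ↦ u) y ≡ u
  ↦-same y u with y ≟ y
  ... | yes _ = refl
  ... | no y≢y = ⊥-elim (y≢y refl)

  ↦-other : ∀ {x y} u → x ≢ y → (y ↦ u) x ≡ var x
  ↦-other {x} {y} u x≢y with x ≟ y
  ... | yes x≡y = ⊥-elim (x≢y x≡y)
  ... | no _ = refl

  unifies-flat-flat : ∀ {σ P Q} h h′ (ys : Vec ℕ (arity h)) (zs : Vec ℕ (arity h′))
                    → Unifies σ (P , h ∙ ys) (Q , h′ ∙ zs) → Unifies collapse (P , h ∙ ys) (Q , h′ ∙ zs)
  unifies-flat-flat h h′ ys zs unif with cong proj₁ unif | head-eq (cong proj₂ unif)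
    where
    head-eq : ∀ {ts ts′} → app h ts ≡ app h′ ts′ → h ≡ h′
    head-eq refl = refl
  ... | refl | refl = cong (λ ts → _ , app h ts)
    (trans (substVec-map-var ys collapse (λ _ → 0) (λ _ _ → refl))
    (trans (cong (Vec.map var) (map-const ys zs)) (sym (substVec-map-var zs collapse (λ _ → 0) (λ _ _ → refl)))))
    where
    map-const : ∀ {n} (us vs : Vec ℕ n) → Vec.map (λ _ → 0) us ≡ Vec.map (λ _ → 0) vs
    map-const Vec.[] Vec.[] = refl
    map-const (_ Vec.∷ us) (_ Vec.∷ vs) = cong (0 Vec.∷_) (map-const us vs)

  unifies-flat-var : ∀ {σ P Q} h (ys : Vec ℕ (arity h)) y → ¬ (y Vec.∈ ys)
                   → Unifies σ (P , h ∙ ys) (Q , var y) → Unifies (y ↦ (h ∙ ys)) (P , h ∙ ys) (Q , var y)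
  unifies-flat-var h ys y y∉ys unif with cong proj₁ unif
  ... | refl = cong (_ ,_) (trans (⟪⟫-fixes (h ∙ ys) fixes) (sym (↦-same y (h ∙ ys))))
    where
    fixes : ∀ x → x occ (h ∙ ys) → (y ↦ (h ∙ ys)) x ≡ var x
    fixes x o = ↦-other (h ∙ ys) (λ { refl → y∉ys (occ-∙⁻ h ys o) })

  -- Some unifier keeps the variables of the flat term a variables (collapse, or y ↦ a), and every
  -- unifier factors through the mgu.
  mgu-renames-flat : ∀ {σ V P Q a b} → FlatTermOver V a → MGU σ (P , a) (Q , b)
                   → FlatTerm b ⊎ (∃[ y ] (b ≡ var y × ¬ V y)) → Renames σ V
  mgu-renames-flat {P = P} {Q} (h , ys , refl , _) mgu (inj₁ (h′ , zs , refl)) x _ =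
    mgu-renames (P , h ∙ ys) (Q , h′ ∙ zs) collapse mgu (unifies-flat-flat h h′ ys zs (proj₁ mgu)) x (0 , refl)
  mgu-renames-flat {P = P} {Q} (h , ys , refl , ys≐V) mgu (inj₂ (y , refl , ¬Vy)) x Vx =
    mgu-renames (P , h ∙ ys) (Q , var y) (y ↦ (h ∙ ys)) mgu (unifies-flat-var h ys y y∉ys (proj₁ mgu))
      x (x , ↦-other (h ∙ ys) (λ { refl → ¬Vy Vx }))
    where
    y∉ys : ¬ (y Vec.∈ ys)
    y∉ys y∈ = ¬Vy (proj₁ (ys≐V y) y∈)

  mgu-renames-var-var : ∀ {σ P Q x y} → MGU σ (P , var x) (Q , var y) → ∀ z → σ z ≡ var (varIndex (σ z))
  mgu-renames-var-var {P = P} {Q} {x} {y} mgu z with cong proj₁ (proj₁ mgu)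
  ... | refl = mgu-renames (P , var x) (Q , var y) collapse mgu refl z (0 , refl)

  -- Propositional entailment

  Sat-⊆ : ∀ {v C D} → (∀ {L} → L ∈ C → L ∈ D) → Sat v C → Sat v D
  Sat-⊆ C⊆D (L , L∈ , holds) = L , C⊆D L∈ , holds

  Sat-variant : ∀ {v D D′} ρ τ → D ≈ (D′ ⟪ ren ρ ⟫C) → Sat v (D′ ⟪ ren ρ ⨾ τ ⟫C) → Sat v (D ⟪ τ ⟫C)
  Sat-variant {D′ = D′} ρ τ (_ , ⊆D) =
    Sat-⊆ (λ L∈ → ⟪⟫C-mono τ ⊆D (subst (_ ∈_) (sym (⟪⟫C-⨾ D′ (ren ρ) τ)) L∈))

  resolvent-sat : ∀ {v D₁ D₂ A B C₁ C₂} σ θ → (∀ {L} → L ∈ D₁ → L ∈ (true , A) ∷ C₁)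
    → (∀ {L} → L ∈ D₂ → L ∈ (false , B) ∷ C₂) → Unifies σ A B
    → Sat v ((D₁ ⟪ σ ⟫C) ⟪ θ ⟫C) → Sat v ((D₂ ⟪ σ ⟫C) ⟪ θ ⟫C)
    → Sat v (((C₁ ⟪ σ ⟫C) ++ (C₂ ⟪ σ ⟫C)) ⟪ θ ⟫C)
  resolvent-sat {v} {D₁} {D₂} {A} {B} {C₁} {C₂} σ θ D₁⊆ D₂⊆ unif (L₁ , L₁∈ , true₁) (L₂ , L₂∈ , true₂)
    with ∈-⟪⟫C⁻ _ θ L₁∈ | ∈-⟪⟫C⁻ _ θ L₂∈
  ... | _ , K₁∈ , refl | _ , K₂∈ , refl with ∈-⟪⟫C⁻ D₁ σ K₁∈ | ∈-⟪⟫C⁻ D₂ σ K₂∈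
  ... | _ , M₁∈ , refl | _ , M₂∈ , refl with D₁⊆ M₁∈ | D₂⊆ M₂∈
  ... | there M₁∈C₁ | _ = _ , ∈-⟪⟫C⁺ _ θ (∈-++⁺ˡ (∈-⟪⟫C⁺ C₁ σ M₁∈C₁)) , true₁
  ... | here refl | there M₂∈C₂ = _ , ∈-⟪⟫C⁺ _ θ (∈-++⁺ʳ (C₁ ⟪ σ ⟫C) (∈-⟪⟫C⁺ C₂ σ M₂∈C₂)) , true₂
  ... | here refl | here refl =
    ⊥-elim (true≢false (trans (sym true₁) (subst (λ a → v (a ⟪ θ ⟫A) ≡ false) (sym unif) true₂)))
    where
    true≢false : true ≢ false
    true≢false ()

  factor-sat : ∀ {v D s A B C₁} σ θ → (∀ {L} → L ∈ D → L ∈ (s , A) ∷ (s , B) ∷ C₁) → Unifies σ A B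
    → Sat v ((D ⟪ σ ⟫C) ⟪ θ ⟫C) → Sat v (((s , (A ⟪ σ ⟫A)) ∷ (C₁ ⟪ σ ⟫C)) ⟪ θ ⟫C)
  factor-sat {v} {D} {s} {C₁ = C₁} σ θ D⊆ unif (L , L∈ , trueL) with ∈-⟪⟫C⁻ _ θ L∈
  ... | _ , K∈ , refl with ∈-⟪⟫C⁻ D σ K∈
  ... | _ , M∈ , refl with D⊆ M∈
  ... | here refl = _ , here refl , trueL
  ... | there (here refl) = _ , here refl , subst (λ a → v (a ⟪ θ ⟫A) ≡ s) (sym unif) trueL
  ... | there (there M∈C₁) = _ , there (∈-⟪⟫C⁺ _ θ (∈-⟪⟫C⁺ C₁ σ M∈C₁)) , trueL

  I-mono : ∀ {T T′} → (∀ C → T C → T′ C) → ∀ D → I T D → I T′ D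
  I-mono T⊆T′ D (inj₁ (C , C∈ , cx , inst)) = inj₁ (C , T⊆T′ C C∈ , cx , inst)
  I-mono T⊆T′ D (inj₂ (inj₁ (B , B∈ , eps , inst))) = inj₂ (inj₁ (B , T⊆T′ B B∈ , eps , inst))
  I-mono T⊆T′ D (inj₂ (inj₂ (B , B∈ , eps , inst))) = inj₂ (inj₂ (B , T⊆T′ B B∈ , eps , inst))

  -- ε-splitting

  AtVar : ℕ → Literal → Set
  AtVar y L = varIndex (argL L) ≡ y

  atVar? : ∀ y → Decidable (AtVar y)
  atVar? y L = varIndex (argL L) ≟ y

  AllTrivial-at⇒EpsBlock : ∀ {P} y → AllTrivial P → (∀ L → L ∈ P → AtVar y L) → EpsBlock P
  AllTrivial-at⇒EpsBlock y trivial at-y = trivial , λ { x x′ (L , L∈ , o) (L′ , L′∈ , o′) →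
    trans (trans (AllTrivial-occ trivial L∈ o) (at-y L L∈))
          (sym (trans (AllTrivial-occ trivial L′∈ o′) (at-y L′ L′∈))) }

  ∈⇒NonEmpty : ∀ {L C} → L ∈ C → NonEmpty C
  ∈⇒NonEmpty () refl

  -- The literals at the variable of the first literal form an ε-block, which splits off unless it is all of P.
  AllTrivial-eps-or-split : ∀ {P} → AllTrivial P → EpsBlock P ⊎ ∃[ C₁ ] ∃[ C₂ ] (Split P C₁ C₂ × EpsBlock C₁)
  AllTrivial-eps-or-split {[]} trivial = inj₁ (AllTrivial-at⇒EpsBlock 0 trivial (λ _ ()))
  AllTrivial-eps-or-split {P@(L₀ ∷ _)} trivial with filter (∁? (atVar? (varIndex (argL L₀)))) P in others≡
  ... | [] = inj₁ (AllTrivial-at⇒EpsBlock _ trivial at-y)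
    where
    at-y : ∀ L → L ∈ P → AtVar (varIndex (argL L₀)) L
    at-y L L∈ with atVar? (varIndex (argL L₀)) L
    ... | yes eq = eq
    ... | no ne with subst (L ∈_) others≡ (∈-filter⁺ (∁? (atVar? _)) L∈ ne)
    ...   | ()
  ... | L₁ ∷ others = inj₂ (filter at-y? P , L₁ ∷ others , split , eps)
    where
    y = varIndex (argL L₀)
    at-y? = atVar? y
    P⊆ : ∀ {L} → L ∈ P → L ∈ filter at-y? P ++ L₁ ∷ others
    P⊆ {L} L∈ with at-y? L
    ... | yes eq = ∈-++⁺ˡ (∈-filter⁺ at-y? L∈ eq)
    ... | no ne = ∈-++⁺ʳ (filter at-y? P) (subst (L ∈_) others≡ (∈-filter⁺ (∁? at-y?) L∈ ne))
    ⊆P : ∀ {L} → L ∈ filter at-y? P ++ L₁ ∷ others → L ∈ P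
    ⊆P L∈ with ∈-++⁻ (filter at-y? P) L∈
    ... | inj₁ L∈at = proj₁ (∈-filter⁻ at-y? {xs = P} L∈at)
    ... | inj₂ L∈others = proj₁ (∈-filter⁻ (∁? at-y?) {xs = P} (subst (_ ∈_) (sym others≡) L∈others))
    disjoint : DisjointVars (filter at-y? P) (L₁ ∷ others)
    disjoint x (L , L∈ , o) (L′ , L′∈ , o′) =
      let L∈P , L-at = ∈-filter⁻ at-y? {xs = P} L∈
          L′∈P , L′-off = ∈-filter⁻ (∁? at-y?) {xs = P} (subst (L′ ∈_) (sym others≡) L′∈)
      in L′-off (trans (sym (AllTrivial-occ {P} {L′} trivial L′∈P o′))
                       (trans (AllTrivial-occ {P} {L} trivial L∈P o) L-at))
    split : Split P (filter at-y? P) (L₁ ∷ others)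
    split = (P⊆ , ⊆P) , ∈⇒NonEmpty (∈-filter⁺ at-y? {xs = P} (here {x = L₀} refl) refl) , (λ ()) , disjoint
    eps : EpsBlock (filter at-y? P)
    eps = AllTrivial-at⇒EpsBlock y (λ L L∈ → trivial L (proj₁ (∈-filter⁻ at-y? {xs = P} L∈)))
                                   (λ L L∈ → proj₂ (∈-filter⁻ at-y? {xs = P} L∈))

  Split-sym : ∀ {C C₁ C₂} → Split C C₁ C₂ → Split C C₂ C₁
  Split-sym {C₁ = C₁} {C₂} ((C⊆ , ⊆C) , ne₁ , ne₂ , disjoint) =
    (swap-++ C₁ C₂ ∘ C⊆ , ⊆C ∘ swap-++ C₂ C₁) , ne₂ , ne₁ , λ x x∈₂ x∈₁ → disjoint x x∈₁ x∈₂
    where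
    swap-++ : ∀ X Y {L} → L ∈ X ++ Y → L ∈ Y ++ X
    swap-++ X Y L∈ with ∈-++⁻ X L∈
    ... | inj₁ L∈X = ∈-++⁺ʳ Y L∈X
    ... | inj₂ L∈Y = ∈-++⁺ˡ L∈Y

  EpsBlock-unsplittable : ∀ {C C₁ C₂} → EpsBlock C → Split C C₁ C₂ → ⊥
  EpsBlock-unsplittable {C₁ = []} _ (_ , ne₁ , _) = ne₁ refl
  EpsBlock-unsplittable {C₁ = _ ∷ _} {[]} _ (_ , _ , ne₂ , _) = ne₂ refl
  EpsBlock-unsplittable {C₁ = L₁ ∷ C₁} {L₂ ∷ _} eps@(trivial , _) ((_ , ⊆C) , _ , _ , disjoint)
    with trivial L₁ (⊆C (here refl))
  ... | y , L₁≡y = disjoint y (L₁ , here refl , var-occ L₁≡y) (L₂ , here refl , var-occ L₂≡y)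
    where
    L₂≡y : argL L₂ ≡ var y
    L₂≡y = EpsBlock-uniform eps (⊆C (here refl)) L₁≡y L₂ (⊆C (∈-++⁺ʳ (L₁ ∷ C₁) (here refl)))

  -- An ε-part would have to share its variable with a complex literal, which contains all variables.
  complex-no-eps-part : ∀ {C C₁ C₂} → Complex C → Split C C₁ C₂ → EpsBlock C₁ → ⊥
  complex-no-eps-part {C₁ = []} _ (_ , ne₁ , _) _ = ne₁ refl
  complex-no-eps-part {C₁ = L ∷ C₁} (flat , K , K∈ , _ , _ , K≡app) ((C⊆ , ⊆C) , _ , _ , disjoint) (trivial , _)
    with trivial L (here refl) | flat K K∈ | ∈-++⁻ (L ∷ C₁) (C⊆ K∈)
  ... | _ | inj₁ (_ , K≡var) | _ = app≢var (trans (sym K≡app) K≡var)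
  ... | _ | _ | inj₁ K∈₁ = app≢var (trans (sym K≡app) (proj₂ (trivial K K∈₁)))
  ... | y , L≡y | inj₂ (h , ws , K≡h , ws↔vars) | inj₂ K∈₂ =
    disjoint y (L , here refl , y-occ-L)
      (K , K∈₂ , subst (y occ_) (sym K≡h) (occ-∙⁺ h ws (proj₂ (ws↔vars y) (L , ⊆C (here refl) , y-occ-L))))
    where
    y-occ-L : y occ argL L
    y-occ-L = var-occ L≡y

  ComplexOrEps-unsplittable : ∀ {C C₁ C₂} → Complex C ⊎ EpsBlock C → Split C C₁ C₂ → EpsBlock C₁ ⊎ EpsBlock C₂ → ⊥
  ComplexOrEps-unsplittable (inj₂ eps) split _ = EpsBlock-unsplittable eps split
  ComplexOrEps-unsplittable (inj₁ cx) split (inj₁ eps₁) = complex-no-eps-part cx split eps₁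
  ComplexOrEps-unsplittable (inj₁ cx) split (inj₂ eps₂) = complex-no-eps-part cx (Split-sym split) eps₂

  ComplexOrEps-unsplittable-branch : ∀ {Br} → ComplexOrEps Br → ¬ EpsSplittable Br
  ComplexOrEps-unsplittable-branch ok (C , _ , _ , C∈ , split , eps-part) =
    ComplexOrEps-unsplittable (ok C C∈) split eps-part

  no-splitting : ∀ {𝒯 𝒯′} → (∀ Br → Br ∈ 𝒯 → ¬ EpsSplittable Br) → Star _→ε_ 𝒯 𝒯′ → 𝒯′ ≡ 𝒯
  no-splitting _ ε = refl
  no-splitting unsplittable ((Br , _ , C , C₁ , C₂ , 𝒯↭ , C∈ , split , eps-part , refl) ◅ _) =
    ⊥-elim (unsplittable Br (∈-resp-↭ (↭-sym 𝒯↭) (here refl)) (C , C₁ , C₂ , C∈ , split , eps-part))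

  module ClausePermutation = PermutationSetoid (setoid Clause)

  -- The conclusion of one inference and the tableau produced from it by φ

  module Inference (S T : ClauseSet) (S-ok : ComplexOrEps S) (S⊑T : S ⊑ T) where

    Models : Valuation → Set
    Models v = ∀ C → I T C → Sat v C

    Entailed : Clause → Set
    Entailed C = ∀ v → Models v → Sat v C

    complex-instance-entailed : ∀ {D η} → S D → Complex D → (∀ x → VarOf x D → Xr (η x)) → Entailed (D ⟪ η ⟫C)
    complex-instance-entailed {D} {η} D∈S cx η∈Xr v M = proj₁ S⊑T D D∈S cx v M (D ⟪ η ⟫C) (η , η∈Xr , ≈-refl)

    -- Only the copy B[x_(r+1)] that S ⊑ T provides is needed: D[u] = (D[x_(r+1)])[u].
    eps-instance-entailed : ∀ {D η u} → S D → EpsBlock D → (U u ⊎ u ≡ var r) → (∀ x → VarOf x D → η x ≡ u)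
                          → Entailed (D ⟪ η ⟫C)
    eps-instance-entailed {D} {η} {u} D∈S eps u-ok η≡u v M with proj₂ S⊑T D D∈S eps
    ... | B , B∈T , epsB , (_ , B⊆D) = Sat-⊆ B[u]⊆D[η] (M (B ⟪ (λ _ → u) ⟫C) (B[u]∈I u-ok))
      where
      B[u]∈I : U u ⊎ u ≡ var r → I T (B ⟪ (λ _ → u) ⟫C)
      B[u]∈I (inj₁ u∈U) = inj₂ (inj₂ (B , B∈T , epsB , (λ _ → u) , (λ _ _ → u∈U) , ≈-refl))
      B[u]∈I (inj₂ u≡r) = inj₂ (inj₁ (B , B∈T , epsB , (λ _ → u) , (λ _ _ → u≡r) , ≈-refl))
      D[r][u]≡D[η] : (D [ r ]v) ⟪ (λ _ → u) ⟫C ≡ D ⟪ η ⟫C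
      D[r][u]≡D[η] = trans (⟪⟫C-⨾ D _ _) (sym (⟪⟫C-local D η≡u))
      B[u]⊆D[η] : ∀ {L} → L ∈ B ⟪ (λ _ → u) ⟫C → L ∈ D ⟪ η ⟫C
      B[u]⊆D[η] L∈ = subst (_ ∈_) D[r][u]≡D[η]
        (⟪⟫C-mono (λ _ → u) B⊆D (subst (_ ∈_) (sym (⟪⟫C-⨾ B (λ _ → var r) (λ _ → u))) L∈))

    Guarded : Term → Clause → Set
    Guarded t E = FlatOver (_occ t) E × (∀ θ → (∀ z → z occ t → Xr (θ z)) → Entailed (E ⟪ θ ⟫C))

    Single : Clause → Set
    Single E = (∃[ z ] Uniform (var z) E) × Entailed (E ⟪ (λ _ → var r) ⟫C)

    record Premise (D : Clause) : Set where
      field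
        {original} : Clause
        rename : ℕ → ℕ
        original∈S : S original
        variant : D ≈ (original ⟪ ren rename ⟫C)

    module _ {D : Clause} (p : Premise D) where
      open Premise p renaming (original to D′; rename to ρ; variant to D≈)

      ComplexSelected : Term → Set
      ComplexSelected a = Complex D′ × FlatTermOver (image ρ (vars D′)) a

      EpsSelected : Term → Set
      EpsSelected a = EpsBlock D′ × ∃[ y ] (a ≡ var y × Uniform (var y) D)

      image-vars : ∀ {y} → image ρ (vars D′) y → VarOf y D
      image-vars (x , (K , K∈ , o) , refl) =
        K ⟪ ren ρ ⟫L , proj₂ D≈ (∈-⟪⟫C⁺ D′ (ren ρ) K∈) , occ-⟪⟫⁺ (argL K) (ren ρ) o occ-var

      complex-variant : Complex D′ → ComplexOver (image ρ (vars D′)) D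
      complex-variant cx = ComplexOver-≈ D≈ (ComplexOver-⟪⟫ (ren ρ) ρ (λ _ _ → refl) D′ (complex⇒ComplexOver cx))

      selected : ∀ {b P a} → (b , P , a) ∈ D → Maximal (b , P , a) D → ComplexSelected a ⊎ EpsSelected a
      selected L∈ max with S-ok D′ original∈S
      ... | inj₁ cx = inj₁ (cx , maximal-flat (complex-variant cx) L∈ max)
      ... | inj₂ eps with proj₁ (EpsBlock-ren ρ eps D≈) _ L∈
      ...   | y , refl = inj₂ (eps , y , refl , EpsBlock-uniform (EpsBlock-ren ρ eps D≈) L∈ refl)

      entailed-⨾ : ∀ σ θ → Entailed (D ⟪ σ ⨾ θ ⟫C) → Entailed ((D ⟪ σ ⟫C) ⟪ θ ⟫C)
      entailed-⨾ σ θ e v M = subst (Sat v) (sym (⟪⟫C-⨾ D σ θ)) (e v M)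

      eps-entailed : EpsBlock D′ → ∀ {y} → Uniform (var y) D → ∀ τ → (U (τ y) ⊎ τ y ≡ var r) → Entailed (D ⟪ τ ⟫C)
      eps-entailed eps {y} unif τ u-ok v M =
        Sat-variant ρ τ D≈ (eps-instance-entailed original∈S eps u-ok ρx≡y v M)
        where
        ρx≡y : ∀ x → VarOf x D′ → τ (ρ x) ≡ τ y
        ρx≡y x x∈ = cong τ (Uniform-var-vars unif (ρ x) (image-vars (x , x∈ , refl)))

      eps-entailed-r : ∀ {y σ w} → EpsBlock D′ → Uniform (var y) D → σ y ≡ var w
                     → Entailed ((D ⟪ σ ⟫C) ⟪ (λ _ → var r) ⟫C)
      eps-entailed-r {σ = σ} eps unif σy≡w =
        entailed-⨾ σ _ (eps-entailed eps unif (σ ⨾ (λ _ → var r)) (inj₂ (cong (_⟪ (λ _ → var r) ⟫) σy≡w)))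

      complex-guarded : ∀ {a σ} → ComplexSelected a → Renames σ (image ρ (vars D′))
                      → FlatTerm (a ⟪ σ ⟫) × Guarded (a ⟪ σ ⟫) (D ⟪ σ ⟫C)
      complex-guarded {a} {σ} (cx , flat-a) σ-ren = FlatTermOver⇒FlatTerm flat-aσ , flat , entailed
        where
        s = λ x → varIndex (σ x)
        flat-aσ : FlatTermOver (image s (image ρ (vars D′))) (a ⟪ σ ⟫)
        flat-aσ = FlatTermOver-⟪⟫ σ s σ-ren a flat-a
        V≐ : image s (image ρ (vars D′)) ≐ (_occ (a ⟪ σ ⟫))
        V≐ = FlatTermOver-occ flat-aσ
        flat : FlatOver (_occ (a ⟪ σ ⟫)) (D ⟪ σ ⟫C)
        flat = FlatOver-resp V≐ (FlatOver-⟪⟫ σ s σ-ren D (proj₁ (complex-variant cx)))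
        entailed : ∀ θ → (∀ z → z occ (a ⟪ σ ⟫) → Xr (θ z)) → Entailed ((D ⟪ σ ⟫C) ⟪ θ ⟫C)
        entailed θ θ∈Xr = entailed-⨾ σ θ λ v M → Sat-variant ρ (σ ⨾ θ) D≈ (complex-instance-entailed original∈S cx in-Xr v M)
          where
          in-Xr : ∀ x → VarOf x D′ → Xr (σ (ρ x) ⟪ θ ⟫)
          in-Xr x x∈ = subst (λ u → Xr (u ⟪ θ ⟫)) (sym (σ-ren (ρ x) (x , x∈ , refl)))
                             (θ∈Xr (s (ρ x)) (proj₁ (V≐ (s (ρ x))) (ρ x , (x , x∈ , refl) , refl)))

      eps-guarded : ∀ {y σ} → EpsBlock D′ → Uniform (var y) D → FlatTerm (σ y) → Guarded (σ y) (D ⟪ σ ⟫C)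
      eps-guarded {y} {σ} eps unif flat-σy = flat , entailed
        where
        flat : FlatOver (_occ (σ y)) (D ⟪ σ ⟫C)
        flat L L∈ = inj₂ (subst (FlatTermOver (_occ (σ y))) (sym (Uniform-⟪⟫ D σ unif L L∈)) (FlatTerm-self flat-σy))
        entailed : ∀ θ → (∀ z → z occ σ y → Xr (θ z)) → Entailed ((D ⟪ σ ⟫C) ⟪ θ ⟫C)
        entailed θ θ∈Xr = entailed-⨾ σ θ (eps-entailed eps unif (σ ⨾ θ) (inj₁ (FlatTerm-U θ flat-σy θ∈Xr)))

    Selected : ∀ {D} → Premise D → Term → Set
    Selected p a = ComplexSelected p a ⊎ EpsSelected p a

    Shape : Clause → Set
    Shape E = ∃[ t ] (FlatTerm t × Guarded t E)

    resolvent-guarded : ∀ {t D₁ D₂ A B C₁ C₂} σ → D₁ ≈ ((true , A) ∷ C₁) → D₂ ≈ ((false , B) ∷ C₂) → Unifies σ A B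
                      → Guarded t (D₁ ⟪ σ ⟫C) → Guarded t (D₂ ⟪ σ ⟫C) → Guarded t ((C₁ ⟪ σ ⟫C) ++ (C₂ ⟪ σ ⟫C))
    resolvent-guarded {C₁ = C₁} {C₂} σ D₁≈ D₂≈ unif (flat₁ , ent₁) (flat₂ , ent₂) =
      FlatOver-++ (C₁ ⟪ σ ⟫C) (C₂ ⟪ σ ⟫C)
        (λ L L∈ → flat₁ L (⟪⟫C-mono σ (λ K∈ → proj₂ D₁≈ (there K∈)) L∈))
        (λ L L∈ → flat₂ L (⟪⟫C-mono σ (λ K∈ → proj₂ D₂≈ (there K∈)) L∈)) ,
      λ θ θ∈Xr v M → resolvent-sat σ θ (proj₁ D₁≈) (proj₁ D₂≈) unif (ent₁ θ θ∈Xr v M) (ent₂ θ θ∈Xr v M)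

    resolvent-uniform : ∀ {t D₁ D₂ C₁ C₂ L₁ L₂} σ → D₁ ≈ (L₁ ∷ C₁) → D₂ ≈ (L₂ ∷ C₂)
                      → Uniform t (D₁ ⟪ σ ⟫C) → Uniform t (D₂ ⟪ σ ⟫C) → Uniform t ((C₁ ⟪ σ ⟫C) ++ (C₂ ⟪ σ ⟫C))
    resolvent-uniform {C₁ = C₁} σ D₁≈ D₂≈ unif₁ unif₂ L L∈ with ∈-++⁻ (C₁ ⟪ σ ⟫C) L∈
    ... | inj₁ L∈₁ = unif₁ L (⟪⟫C-mono σ (λ K∈ → proj₂ D₁≈ (there K∈)) L∈₁)
    ... | inj₂ L∈₂ = unif₂ L (⟪⟫C-mono σ (λ K∈ → proj₂ D₂≈ (there K∈)) L∈₂)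

    resolvent-shape : ∀ {D₁ D₂ C₁ C₂ P Q a b σ} → D₁ ≈ ((true , P , a) ∷ C₁) → D₂ ≈ ((false , Q , b) ∷ C₂)
      → MGU σ (P , a) (Q , b) → FlatTerm (a ⟪ σ ⟫) → Guarded (a ⟪ σ ⟫) (D₁ ⟪ σ ⟫C) → Guarded (b ⟪ σ ⟫) (D₂ ⟪ σ ⟫C)
      → Shape ((C₁ ⟪ σ ⟫C) ++ (C₂ ⟪ σ ⟫C))
    resolvent-shape {D₂ = D₂} {σ = σ} D₁≈ D₂≈ mgu flat g₁ g₂ =
      _ , flat , resolvent-guarded σ D₁≈ D₂≈ (proj₁ mgu) g₁
                   (subst (λ t → Guarded t (D₂ ⟪ σ ⟫C)) (sym (cong proj₂ (proj₁ mgu))) g₂)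

    resolution-shape : ∀ {D₁ D₂ C₁ C₂ P Q a b σ} (p₁ : Premise D₁) (p₂ : Premise D₂) → DisjointVars D₁ D₂
      → D₁ ≈ ((true , P , a) ∷ C₁) → D₂ ≈ ((false , Q , b) ∷ C₂) → MGU σ (P , a) (Q , b)
      → Selected p₁ a → Selected p₂ b → Shape ((C₁ ⟪ σ ⟫C) ++ (C₂ ⟪ σ ⟫C)) ⊎ Single ((C₁ ⟪ σ ⟫C) ++ (C₂ ⟪ σ ⟫C))
    resolution-shape {P = P} {Q} {a} {b} p₁ p₂ _ D₁≈ D₂≈ mgu (inj₁ c₁) (inj₁ c₂) =
      let flat , g₁ = complex-guarded p₁ c₁ (mgu-renames-flat (proj₂ c₁) mgu (inj₁ (FlatTermOver⇒FlatTerm (proj₂ c₂))))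
          _ , g₂ = complex-guarded p₂ c₂
                     (mgu-renames-flat (proj₂ c₂) (mgu-sym (P , a) (Q , b) mgu) (inj₁ (FlatTermOver⇒FlatTerm (proj₂ c₁))))
      in inj₁ (resolvent-shape D₁≈ D₂≈ mgu flat g₁ g₂)
    resolution-shape p₁ p₂ disjoint D₁≈ D₂≈ mgu (inj₁ c₁) (inj₂ (eps₂ , y , refl , unif₂)) =
      let flat , g₁ = complex-guarded p₁ c₁ (mgu-renames-flat (proj₂ c₁) mgu (inj₂ (y , refl , y∉D₁)))
          g₂ = eps-guarded p₂ eps₂ unif₂ (subst FlatTerm (cong proj₂ (proj₁ mgu)) flat)
      in inj₁ (resolvent-shape D₁≈ D₂≈ mgu flat g₁ g₂)
      where
      y∉D₁ : ¬ image (Premise.rename p₁) (vars (Premise.original p₁)) y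
      y∉D₁ y∈ = disjoint y (image-vars p₁ y∈) (_ , proj₂ D₂≈ (here refl) , occ-var)
    resolution-shape {P = P} {Q} {a} {b} p₁ p₂ disjoint D₁≈ D₂≈ mgu (inj₂ (eps₁ , x , refl , unif₁)) (inj₁ c₂) =
      let flat , g₂ = complex-guarded p₂ c₂
                        (mgu-renames-flat (proj₂ c₂) (mgu-sym (P , a) (Q , b) mgu) (inj₂ (x , refl , x∉D₂)))
          flat-σx = subst FlatTerm (sym (cong proj₂ (proj₁ mgu))) flat
      in inj₁ (resolvent-shape D₁≈ D₂≈ mgu flat-σx (eps-guarded p₁ eps₁ unif₁ flat-σx) g₂)
      where
      x∉D₂ : ¬ image (Premise.rename p₂) (vars (Premise.original p₂)) x
      x∉D₂ x∈ = disjoint x (_ , proj₂ D₁≈ (here refl) , occ-var) (image-vars p₂ x∈)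
    resolution-shape {D₁} {D₂} {P = P} {Q} {σ = σ} p₁ p₂ _ D₁≈ D₂≈ mgu
                     (inj₂ (eps₁ , x , refl , unif₁)) (inj₂ (eps₂ , y , refl , unif₂)) =
      inj₂ ((_ , resolvent-uniform σ D₁≈ D₂≈ (subst (λ t → Uniform t (D₁ ⟪ σ ⟫C)) σx≡z (Uniform-⟪⟫ D₁ σ unif₁))
                                            (subst (λ t → Uniform t (D₂ ⟪ σ ⟫C)) σy≡z (Uniform-⟪⟫ D₂ σ unif₂))) ,
            λ v M → resolvent-sat σ _ (proj₁ D₁≈) (proj₁ D₂≈) (proj₁ mgu)
                      (eps-entailed-r p₁ eps₁ unif₁ σx≡z v M) (eps-entailed-r p₂ eps₂ unif₂ σy≡z v M))
      where
      σx≡z : σ x ≡ var (varIndex (σ x))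
      σx≡z = mgu-renames-var-var {P = P} {Q} {x} {y} mgu x
      σy≡z : σ y ≡ var (varIndex (σ x))
      σy≡z = trans (sym (cong proj₂ (proj₁ mgu))) σx≡z

    identity-premise : ∀ {D} → S D → Premise D
    identity-premise {D} D∈S =
      record { rename = λ x → x ; original∈S = D∈S ; variant = subst (D ≈_) (sym (⟪var⟫C D)) ≈-refl }

    factor-⊆ : ∀ {D s A B C₁} σ → D ≈ ((s , A) ∷ (s , B) ∷ C₁)
             → ∀ {L} → L ∈ (s , (A ⟪ σ ⟫A)) ∷ (C₁ ⟪ σ ⟫C) → L ∈ D ⟪ σ ⟫C
    factor-⊆ {D} σ D≈ (here refl) = ∈-⟪⟫C⁺ D σ (proj₂ D≈ (here refl))
    factor-⊆ σ D≈ (there L∈) = ⟪⟫C-mono σ (λ K∈ → proj₂ D≈ (there (there K∈))) L∈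

    factorization-shape : ∀ {D s P Q a b C₁ σ} (p : Premise D) → D ≈ ((s , P , a) ∷ (s , Q , b) ∷ C₁)
      → Maximal (s , Q , b) D → MGU σ (P , a) (Q , b) → Selected p a
      → Shape ((s , (P , a) ⟪ σ ⟫A) ∷ (C₁ ⟪ σ ⟫C)) ⊎ Single ((s , (P , a) ⟪ σ ⟫A) ∷ (C₁ ⟪ σ ⟫C))
    factorization-shape {σ = σ} p D≈ max-b mgu (inj₁ c) =
      let flat-b = maximal-flat (complex-variant p (proj₁ c)) (proj₂ D≈ (there (here refl))) max-b
          flat , flat-over , entailed =
            complex-guarded p c (mgu-renames-flat (proj₂ c) mgu (inj₁ (FlatTermOver⇒FlatTerm flat-b)))
      in inj₁ (_ , flat , (λ L L∈ → flat-over L (factor-⊆ σ D≈ L∈)) ,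
               λ θ θ∈Xr v M → factor-sat σ θ (proj₁ D≈) (proj₁ mgu) (entailed θ θ∈Xr v M))
    factorization-shape {D} {P = P} {Q} {b = b} {σ = σ} p D≈ _ mgu (inj₂ (eps , y , refl , unif))
      with unif _ (proj₂ D≈ (there (here refl)))
    ... | refl = inj₂ ((_ , λ L L∈ → trans (Uniform-⟪⟫ D σ unif L (factor-⊆ σ D≈ L∈)) σy≡z) ,
                      λ v M → factor-sat σ _ (proj₁ D≈) (proj₁ mgu) (eps-entailed-r p eps unif σy≡z v M))
      where
      σy≡z : σ y ≡ var (varIndex (σ y))
      σy≡z = mgu-renames-var-var {σ} {P} {Q} {y} {y} mgu y

    step-shape : ∀ {E} → Resolvent S E ⊎ Factor S E → Shape E ⊎ Single E
    step-shape (inj₁ (_ , _ , _ , _ , _ , _ , _ , _ , _ , D₁′∈S , D₂′∈S , (ρ₁ , _ , D₁≈′) , (ρ₂ , _ , D₂≈′) ,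
                      disjoint , D₁≈ , _ , D₂≈ , _ , max₁ , max₂ , mgu , refl)) =
      resolution-shape p₁ p₂ disjoint D₁≈ D₂≈ mgu
        (selected p₁ (proj₂ D₁≈ (here refl)) max₁) (selected p₂ (proj₂ D₂≈ (here refl)) max₂)
      where
      p₁ = record { rename = ρ₁ ; original∈S = D₁′∈S ; variant = D₁≈′ }
      p₂ = record { rename = ρ₂ ; original∈S = D₂′∈S ; variant = D₂≈′ }
    step-shape (inj₂ (_ , _ , _ , _ , _ , _ , D∈S , D≈ , max-a , max-b , mgu , refl)) =
      factorization-shape p D≈ max-b mgu (selected p (proj₂ D≈ (here refl)) max-a)
      where
      p = identity-premise D∈S

    Trivial : Clause → Set
    Trivial E = AllTrivial E × Σ (ℕ → ℕ) λ θ → (∀ x → VarOf x E → θ x ≤ r)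
              × (∀ x y → VarOf x E → VarOf y E → θ x ≡ θ y → x ≡ y) × Entailed (E ⟪ ren θ ⟫C)

    Outcome : Clause → Set
    Outcome E = (Complex E × I T ⊨p π E) ⊎ Trivial E

    single-trivial : ∀ {E} → Single E → Trivial E
    single-trivial ((z , unif) , entailed) =
      (λ L L∈ → z , unif L L∈) , (λ _ → r) , (λ _ _ → ≤-refl) ,
      (λ x y x∈ y∈ _ → trans (Uniform-var-vars unif x x∈) (sym (Uniform-var-vars unif y y∈))) , entailed

    shape-outcome : ∀ {E} → Shape E → Outcome E
    shape-outcome {E} (t , (g , W , refl) , flat , entailed) with complex-or-trivial E
    ... | inj₁ (K , K∈ , K-app) = inj₁ (ComplexOver⇒complex complexE , π-entailed)
      where
      flat-K : FlatTermOver (_occ t) (argL K)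
      flat-K with flat K K∈
      ... | inj₁ (_ , eq , _) = ⊥-elim (app≢var (trans (sym (proj₂ (proj₂ K-app))) eq))
      ... | inj₂ ft = ft
      complexE : ComplexOver (_occ t) E
      complexE = flat , K , K∈ , flat-K
      π-entailed : I T ⊨p π E
      π-entailed v M D (θ , θ∈Xr , _ , Eθ⊆D) =
        Sat-⊆ Eθ⊆D (entailed θ (λ z o → θ∈Xr z (proj₁ (ComplexOver-vars complexE z) o)) v M)
    ... | inj₂ trivial = inj₂ (trivial , position W , bound , injective , entailed (ren (position W)) θ∈Xr)
      where
      vars-W : ∀ x → VarOf x E → x Vec.∈ W
      vars-W x (L , L∈ , o) = occ-∙⁻ g W (FlatLitOver-vars {_occ t} {L} (flat L L∈) o)
      bound : ∀ x → VarOf x E → position W x ≤ r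
      bound x x∈ = <⇒≤ (≤-trans (position< W (vars-W x x∈)) (r-bound g))
      injective : ∀ x y → VarOf x E → VarOf y E → position W x ≡ position W y → x ≡ y
      injective x y x∈ y∈ = position-injective W (vars-W x x∈) (vars-W y y∈)
      θ∈Xr : ∀ z → z occ t → Xr (ren (position W) z)
      θ∈Xr z o = position W z , ≤-trans (position< W (occ-∙⁻ g W o)) (r-bound g) , refl

    step-outcome : ∀ {E} → Resolvent S E ⊎ Factor S E → Outcome E
    step-outcome step = [ shape-outcome , inj₂ ∘ single-trivial ] (step-shape step)

    ⊑-insert : ∀ {Br P T′} → (∀ X → Br X → S X ⊎ X ≡ P) → (∀ C → T C → T′ C)
             → (Complex P → I T′ ⊨p π P) → (EpsBlock P → ∃[ B ] (T′ B × EpsBlock B × (P [ r ]v) ≈ (B [ r ]v)))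
             → Br ⊑ T′
    ⊑-insert {Br} {P} {T′} Br⊆ T⊆T′ complexP epsP = complex-part , eps-part
      where
      complex-part : ∀ C → Br C → Complex C → I T′ ⊨p π C
      complex-part C C∈ cx with Br⊆ C C∈
      ... | inj₁ C∈S = λ v M → proj₁ S⊑T C C∈S cx v (λ D D∈ → M D (I-mono T⊆T′ D D∈))
      ... | inj₂ refl = complexP cx
      eps-part : ∀ C → Br C → EpsBlock C → ∃[ B ] (T′ B × EpsBlock B × (C [ r ]v) ≈ (B [ r ]v))
      eps-part C C∈ eps with Br⊆ C C∈
      ... | inj₁ C∈S = let B , B∈T , epsB , C≈B = proj₂ S⊑T C C∈S eps in B , T⊆T′ B B∈T , epsB , C≈B
      ... | inj₂ refl = epsP eps

    ComplexOrEps-inherited : ∀ {Br P} → (∀ X → Br X → S X ⊎ X ≡ P) → Complex P ⊎ EpsBlock P → ComplexOrEps Br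
    ComplexOrEps-inherited Br⊆ P-ok X X∈ with Br⊆ X X∈
    ... | inj₁ X∈S = S-ok X X∈S
    ... | inj₂ refl = P-ok

    Conclusion : Tableau → Set₁
    Conclusion 𝒯 = (∀ B → B ∈ 𝒯 → ComplexOrEps B) × ∃[ 𝒯′ ] ((T ∷ []) ▶* 𝒯′ × 𝒯 ⊑T 𝒯′)

    module Splitting (E : Clause) where

      Descends : ClauseSet → Clause → Set
      Descends Br P = (∀ X → Br X → S X ⊎ X ≡ P) × Br P × (∀ {L} → L ∈ P → L ∈ E)

      -- Only an unsplit E may be empty (E = □); an ε-clause admits that for its first block.
      Partition : List Clause → Set
      Partition Ps = (∀ L → L ∈ E → Any (L ∈_) Ps) × AllPairs DisjointVars Ps × (length Ps ≡ 1 ⊎ All NonEmpty Ps)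

      Invariant : Tableau → Set₁
      Invariant 𝒯 = ∃[ Ps ] (Pointwise Descends 𝒯 Ps × Partition Ps × Ps ≢ [])

      Partition-↭ : ∀ {Ps Ps′} → Partition Ps → Ps ↭ Ps′ → Partition Ps′
      Partition-↭ (covers , disjoint , sizes) Ps↭ =
        (λ L L∈ → Any-resp-↭ Ps↭ (covers L L∈)) ,
        ClausePermutation.AllPairs-resp-↭ (λ d x x∈₁ x∈₂ → d x x∈₂ x∈₁) (resp₂ DisjointVars) (↭⇒↭ₛ Ps↭) disjoint ,
        [ (λ one → inj₁ (trans (sym (↭-length Ps↭)) one)) , (λ nonempty → inj₂ (All-resp-↭ Ps↭ nonempty)) ] sizes

      tail-nonempty : ∀ {P} Qs → length (P ∷ Qs) ≡ 1 ⊎ All NonEmpty (P ∷ Qs) → All NonEmpty Qs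
      tail-nonempty [] _ = []
      tail-nonempty (_ ∷ _) (inj₂ (_ ∷ nonempty)) = nonempty

      initial : Invariant ((S ∪｛ E ｝) ∷ [])
      initial =
        E ∷ [] , ((λ _ X∈ → X∈) , inj₂ refl , (λ L∈ → L∈)) ∷ [] , ((λ _ L∈ → here L∈) , [] ∷ [] , inj₁ refl) , (λ ())

      splitting-step : ∀ {𝒯 𝒯′} → Invariant 𝒯 → 𝒯 →ε 𝒯′ → Invariant 𝒯′
      splitting-step (Ps , descends , partition , _) (Br , R , C , C₁ , C₂ , 𝒯↭ , C∈Br , split , eps-part , refl)
        with Pointwise-↭ descends 𝒯↭
      ... | P ∷ Qs , Ps↭ , (Br⊆ , _ , P⊆E) ∷ descendsR with Br⊆ C C∈Br
      ...   | inj₁ C∈S = ⊥-elim (ComplexOrEps-unsplittable (S-ok C C∈S) split eps-part)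
      ...   | inj₂ refl with Partition-↭ partition Ps↭ | split
      ...     | covers , (C-disjoint ∷ disjointQs) , sizes | (C⊆ , ⊆C) , nonempty₁ , nonempty₂ , disjoint₁₂ =
        C₁ ∷ C₂ ∷ Qs ,
        descends-part C₁ C₁⊆C ∷ descends-part C₂ C₂⊆C ∷ descendsR ,
        (covers′ ,
         (disjoint₁₂ ∷ All.map (DisjointVars-⊆ C₁⊆C) C-disjoint) ∷ All.map (DisjointVars-⊆ C₂⊆C) C-disjoint ∷ disjointQs ,
         inj₂ (nonempty₁ ∷ nonempty₂ ∷ tail-nonempty Qs sizes)) ,
        (λ ())
        where
        C₁⊆C : ∀ {L} → L ∈ C₁ → L ∈ C
        C₁⊆C L∈ = ⊆C (∈-++⁺ˡ L∈)
        C₂⊆C : ∀ {L} → L ∈ C₂ → L ∈ C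
        C₂⊆C L∈ = ⊆C (∈-++⁺ʳ C₁ L∈)
        descends-part : ∀ Cᵢ → (∀ {L} → L ∈ Cᵢ → L ∈ C) → Descends ((Br ∖｛ C ｝) ∪｛ Cᵢ ｝) Cᵢ
        descends-part Cᵢ Cᵢ⊆C = inherited , inj₂ refl , (λ L∈ → P⊆E (Cᵢ⊆C L∈))
          where
          inherited : ∀ X → ((Br ∖｛ C ｝) ∪｛ Cᵢ ｝) X → S X ⊎ X ≡ Cᵢ
          inherited X (inj₁ (X∈Br , X≉C)) with Br⊆ X X∈Br
          ... | inj₁ X∈S = inj₁ X∈S
          ... | inj₂ refl = ⊥-elim (X≉C ≈-refl)
          inherited X (inj₂ X≡Cᵢ) = inj₂ X≡Cᵢ
        covers′ : ∀ L → L ∈ E → Any (L ∈_) (C₁ ∷ C₂ ∷ Qs)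
        covers′ L L∈ with covers L L∈
        ... | there L∈Qs = there (there L∈Qs)
        ... | here L∈C with ∈-++⁻ C₁ (C⊆ L∈C)
        ...   | inj₁ L∈₁ = here L∈₁
        ...   | inj₂ L∈₂ = there (here L∈₂)

      splitting-invariant : ∀ {𝒯 𝒯′} → Invariant 𝒯 → Star _→ε_ 𝒯 𝒯′ → Invariant 𝒯′
      splitting-invariant inv ε = inv
      splitting-invariant inv (step ◅ steps) = splitting-invariant (splitting-step inv step) steps

      Part : Clause → Set
      Part P = EpsBlock P × (∀ {L} → L ∈ P → L ∈ E)

      EpsDescends : ClauseSet → Clause → Set
      EpsDescends Br P = Descends Br P × EpsBlock P

      saturated-parts-eps : ∀ {𝒯 Ps} → AllTrivial E → (∀ Br → Br ∈ 𝒯 → ¬ EpsSplittable Br)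
                          → Pointwise Descends 𝒯 Ps → Pointwise EpsDescends 𝒯 Ps
      saturated-parts-eps trivial saturated [] = []
      saturated-parts-eps trivial saturated (descends@(_ , P∈Br , P⊆E) ∷ rest)
        with AllTrivial-eps-or-split (λ L L∈ → trivial L (P⊆E L∈))
      ... | inj₁ eps = (descends , eps) ∷ saturated-parts-eps trivial (λ Br Br∈ → saturated Br (there Br∈)) rest
      ... | inj₂ (C₁ , C₂ , split , eps₁) = ⊥-elim (saturated _ (here refl) (_ , C₁ , C₂ , P∈Br , split , inj₁ eps₁))

      branches-ok : ∀ {𝒯 Ps} → Pointwise EpsDescends 𝒯 Ps → ∀ B → B ∈ 𝒯 → ComplexOrEps B
      branches-ok (((Br⊆ , _) , eps) ∷ _) _ (here refl) = ComplexOrEps-inherited Br⊆ (inj₂ eps)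
      branches-ok (_ ∷ rest) B (there B∈) = branches-ok rest B B∈

      parts : ∀ {𝒯 Ps} → Pointwise EpsDescends 𝒯 Ps → All Part Ps
      parts [] = []
      parts (((_ , _ , P⊆E) , eps) ∷ rest) = (eps , P⊆E) ∷ parts rest

      ⊑-parts : ∀ {𝒯 Ps} (f : Clause → ℕ) → Pointwise EpsDescends 𝒯 Ps
              → Pointwise _⊑_ 𝒯 (map (λ p → T ∪｛ proj₁ p ｝) (map (λ P → P , f P) Ps))
      ⊑-parts f [] = []
      ⊑-parts f (((Br⊆ , _) , eps) ∷ rest) =
        ⊑-insert Br⊆ (λ _ → inj₁) (λ cx → ⊥-elim (complex-not-EpsBlock cx eps)) (λ _ → _ , inj₂ refl , eps , ≈-refl)
        ∷ ⊑-parts f rest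

      -- A part P is an ε-block, so θ is constant on its variables: the instance E θ is covered
      -- by the blocks P[x_(θ y_P)].
      module Blocks (θ : ℕ → ℕ) (injective : ∀ x y → VarOf x E → VarOf y E → θ x ≡ θ y → x ≡ y) where

        blockIndex : Clause → ℕ
        blockIndex [] = r
        blockIndex (L ∷ _) = θ (varIndex (argL L))

        block : Clause → Clause × ℕ
        block P = P , blockIndex P

        Part-first-var : ∀ {L P} → Part (L ∷ P) → VarOf (varIndex (argL L)) (L ∷ P)
        Part-first-var {b , Q , t} ((trivial , _) , _) with trivial _ (here refl)
        ... | w , refl = _ , here refl , occ-var

        blockIndex-bound : (∀ x → VarOf x E → θ x ≤ r) → ∀ {P} → Part P → blockIndex P ≤ r
        blockIndex-bound bound {[]} _ = ≤-refl
        blockIndex-bound bound {L ∷ P} part@(_ , P⊆E) = bound _ (VarOf-⊆ P⊆E (Part-first-var part))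

        block-vars : ∀ {z} P → VarOf z (blockAt (block P)) → z ≡ blockIndex P × NonEmpty P
        block-vars P (L , L∈ , o) with ∈-⟪⟫C⁻ P _ L∈
        ... | K , K∈ , refl with occ-⟪⟫⁻ (argL K) _ o
        ... | _ , _ , occ-var = refl , ∈⇒NonEmpty K∈

        blocks-disjoint : ∀ {P Q} → Part P → Part Q → DisjointVars P Q
                        → DisjointVars (blockAt (block P)) (blockAt (block Q))
        blocks-disjoint {[]} _ _ _ z z∈ _ = proj₂ (block-vars [] z∈) refl
        blocks-disjoint {_ ∷ _} {[]} _ _ _ z _ z∈ = proj₂ (block-vars [] z∈) refl
        blocks-disjoint {L₁ ∷ P} {L₂ ∷ Q} partP@(_ , P⊆E) partQ@(_ , Q⊆E) disjoint z z∈P z∈Q =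
          disjoint _ (Part-first-var partP) (subst (λ y → VarOf y (L₂ ∷ Q)) (sym same-var) (Part-first-var partQ))
          where
          same-var : varIndex (argL L₁) ≡ varIndex (argL L₂)
          same-var = injective _ _ (VarOf-⊆ P⊆E (Part-first-var partP)) (VarOf-⊆ Q⊆E (Part-first-var partQ))
            (trans (sym (proj₁ (block-vars (L₁ ∷ P) z∈P))) (proj₁ (block-vars (L₂ ∷ Q) z∈Q)))

        ∈-block : ∀ {L P} → Part P → L ∈ P → L ⟪ ren θ ⟫L ∈ blockAt (block P)
        ∈-block {b , Q , t} {L₁ ∷ P} part@((trivial , one-var) , _) L∈ with trivial _ L∈
        ... | w , refl = subst (_∈ blockAt (block (L₁ ∷ P))) (cong (λ u → b , Q , var (θ u)) same-var)
                                (∈-⟪⟫C⁺ (L₁ ∷ P) _ L∈)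
          where
          same-var : varIndex (argL L₁) ≡ w
          same-var = one-var _ w (Part-first-var part) (_ , L∈ , occ-var)

        ∈-blocks : ∀ {L Ps} → All Part Ps → Any (L ∈_) Ps → L ⟪ ren θ ⟫L ∈ epsClause (map block Ps)
        ∈-blocks (part ∷ _) (here L∈) = ∈-++⁺ˡ (∈-block part L∈)
        ∈-blocks {Ps = P ∷ _} (_ ∷ parts) (there L∈) = ∈-++⁺ʳ (blockAt (block P)) (∈-blocks parts L∈)

      trivial-conclusion : ∀ {𝒯} → Trivial E → IsPhi ((S ∪｛ E ｝) ∷ []) 𝒯 → Conclusion 𝒯
      trivial-conclusion (trivial , θ , bound , injective , entailed) (splits , saturated)
        with splitting-invariant initial splits
      ... | [] , _ , _ , nonempty = ⊥-elim (nonempty refl)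
      ... | P ∷ Ps , descends , (covers , disjoint , sizes) , _ =
        branches-ok eps-descends , _ , abstract-step ◅ ε ,
        (_ , ↭-refl , subst (Pointwise _⊑_ _) (sym (++-identityʳ _)) (⊑-parts blockIndex eps-descends))
        where
        open Blocks θ injective
        eps-descends = saturated-parts-eps trivial saturated descends
        all-parts = parts eps-descends
        bs = map block (P ∷ Ps)
        eps-clause : EpsClause bs
        eps-clause = Allₚ.map⁺ (All.map proj₁ all-parts) ,
                     Allₚ.map⁺ (All.map (blockIndex-bound bound) all-parts) ,
                     AllPairsₚ.map⁺ (AllPairs-restrict blocks-disjoint all-parts disjoint) ,
                     Allₚ.map⁺ (tail-nonempty Ps sizes)
        entails : I T ⊨p (λ D → D ≡ epsClause bs)
        entails v M D refl = Sat-⊆ Eθ⊆ (entailed v M)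
          where
          Eθ⊆ : ∀ {L} → L ∈ E ⟪ ren θ ⟫C → L ∈ epsClause bs
          Eθ⊆ L∈ with ∈-⟪⟫C⁻ E (ren θ) L∈
          ... | K , K∈ , refl = ∈-blocks all-parts (covers K K∈)
        abstract-step : (T ∷ []) ▶ (map (λ p → T ∪｛ proj₁ p ｝) bs ++ [])
        abstract-step = T , [] , bs , ↭-refl , eps-clause , entails , refl

    branch-ok : ∀ {E} → Complex E → ComplexOrEps (S ∪｛ E ｝)
    branch-ok cx = ComplexOrEps-inherited (λ _ X∈ → X∈) (inj₁ cx)

    complex-conclusion : ∀ {E 𝒯} → Complex E → I T ⊨p π E → Star _→ε_ ((S ∪｛ E ｝) ∷ []) 𝒯 → Conclusion 𝒯
    complex-conclusion {E} cx π-entailed splits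
      with no-splitting (λ { _ (here refl) → ComplexOrEps-unsplittable-branch (branch-ok cx) }) splits
    ... | refl =
      (λ { _ (here refl) → branch-ok cx }) , T ∷ [] , ε ,
      (T ∷ [] , ↭-refl , ⊑-insert (λ _ X∈ → X∈) (λ _ C∈ → C∈) (λ _ → π-entailed)
                                   (λ eps → ⊥-elim (complex-not-EpsBlock cx eps)) ∷ [])

lemma7 : (sig : Signature) → let open Syntax sig in
    ∀ (S T : ClauseSet) → ComplexOrEps S → ComplexOrEps T → S ⊑ T →
    ∀ (𝒯 : Tableau) → (S ∷ []) ⇒φ 𝒯 →
      (∀ B → B ∈ 𝒯 → ComplexOrEps B)
      × ∃[ 𝒯' ] ((T ∷ []) ▶* 𝒯' × 𝒯 ⊑T 𝒯')
lemma7 sig S T S-ok _ S⊑T 𝒯 (_ , (_ , _ , E , 𝒯↭ , step , refl) , φ) with ↭-singleton-inv (↭-sym 𝒯↭)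
... | refl =
  [ (λ (complex , π-entailed) → complex-conclusion complex π-entailed (proj₁ φ))
  , (λ trivial → Splitting.trivial-conclusion E trivial φ)
  ] (step-outcome step)
  where
  open Inference sig S T S-ok S⊑T
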